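{- Let $G$ be a finite simple chordal graph. Then $\mathcal{N}(\overline{G})$ collapses to (a subcomplex isomorphic to) the neighborhood complex $\mathcal{N}(K_{\alpha(G)})$ of the complete graph $K_{\alpha(G)}$; in particular $\mathcal{N}(\overline{G})\simeq S^{\alpha(G)-2}$.
   Context: A graph is chordal if it has no induced cycle of length at least $4$. $\overline{G}$ is the complement graph, $\alpha(G)$ the independence number, $K_m$ the complete graph on $m$ vertices. The neighborhood complex $\mathcal{N}(H)$ is the simplicial complex on $V(H)$ whose simplices are the subsets contained in the set of neighbors $N_H(v)$ of some vertex $v$. A face $\sigma$ of a simplicial complex is free if it is not maximal and lies in exactly one other face; removing all faces containing a free face is a simplicial collapse, and $X$ collapses to $Y$ if $Y$ is obtained from $X$ by finitely many simplicial collapses. -}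

module Defs where

open import Data.Nat using (ℕ; zero; suc; _+_; _≤_)
open import Data.Nat.DivMod using (_%_)
open import Data.Fin using (Fin; toℕ; _≟_)
open import Data.Fin.Subset using (Subset; Side; inside; outside; _∈_; _⊆_; _⊂_; ∣_∣)
open import Data.Bool using (Bool; true; false; not; _∧_; if_then_else_)
open import Data.Vec using (tabulate)
open import Data.Product using (Σ; ∃; _×_; _,_)
open import Data.Sum using (_⊎_)
open import Relation.Nullary using (¬_)
open import Relation.Nullary.Decidable using (⌊_⌋)
open import Relation.Binary.PropositionalEquality using (_≡_)
open import Function.Bundles using (_⇔_)
open import Function.Definitions using (Injective)

record Graph (n : ℕ) : Set where
  field
    adj   : Fin n → Fin n → Bool
    adj-sym    : ∀ u v → adj u v ≡ adj v u
    adj-irrefl : ∀ v → adj v v ≡ false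

open Graph public

Adj : {n : ℕ} → Graph n → Fin n → Fin n → Set
Adj G u v = adj G u v ≡ true

complement : {n : ℕ} → Graph n → Graph n
complement {n} G = record
  { adj = λ u v → not (adj G u v) ∧ not ⌊ u ≟ v ⌋
  ; adj-sym = symP
  ; adj-irrefl = irr
  }
  where
  open import Relation.Binary.PropositionalEquality using (refl; cong₂; cong)
  open import Relation.Nullary using (yes; no)
  open import Relation.Binary.PropositionalEquality using (sym)
  ≟-sym : ∀ (u v : Fin n) → ⌊ u ≟ v ⌋ ≡ ⌊ v ≟ u ⌋
  ≟-sym u v with u ≟ v | v ≟ u
  ... | yes _ | yes _ = refl
  ... | no _  | no _  = refl
  ... | yes p | no q  = Data.Empty.⊥-elim (q (sym p))
    where import Data.Empty
  ... | no p  | yes q = Data.Empty.⊥-elim (p (sym q))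
    where import Data.Empty
  symP : ∀ u v → (not (adj G u v) ∧ not ⌊ u ≟ v ⌋) ≡ (not (adj G v u) ∧ not ⌊ v ≟ u ⌋)
  symP u v = cong₂ (λ a b → not a ∧ not b) (adj-sym G u v) (≟-sym u v)
  irr : ∀ v → (not (adj G v v) ∧ not ⌊ v ≟ v ⌋) ≡ false
  irr v with v ≟ v
  ... | yes _ = Data.Bool.Properties.∧-zeroʳ (not (adj G v v))
    where import Data.Bool.Properties
  ... | no q = Data.Empty.⊥-elim (q refl)
    where import Data.Empty

complete : (m : ℕ) → Graph m
complete m = record
  { adj = λ u v → not ⌊ u ≟ v ⌋
  ; adj-sym = symP
  ; adj-irrefl = irr
  }
  where
  open import Relation.Binary.PropositionalEquality using (refl; cong; sym)
  open import Relation.Nullary using (yes; no)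
  import Data.Empty
  symP : ∀ (u v : Fin m) → not ⌊ u ≟ v ⌋ ≡ not ⌊ v ≟ u ⌋
  symP u v with u ≟ v | v ≟ u
  ... | yes _ | yes _ = refl
  ... | no _  | no _  = refl
  ... | yes p | no q  = Data.Empty.⊥-elim (q (sym p))
  ... | no p  | yes q = Data.Empty.⊥-elim (p (sym q))
  irr : ∀ (v : Fin m) → not ⌊ v ≟ v ⌋ ≡ false
  irr v with v ≟ v
  ... | yes _ = refl
  ... | no q = Data.Empty.⊥-elim (q refl)

-- Induced cycle of length k + 4 (i.e. length ≥ 4): an injective map
-- c : Fin (k+4) → V such that c i, c j are adjacent iff i and j are
-- cyclically consecutive.
CyclicAdj : (m : ℕ) → .{{_ : Data.Nat.NonZero m}} → Fin m → Fin m → Set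
CyclicAdj m i j = (suc (toℕ i) % m ≡ toℕ j) ⊎ (suc (toℕ j) % m ≡ toℕ i)
  where import Data.Nat

InducedCycle : {n : ℕ} → Graph n → (k : ℕ) → (Fin (4 + k) → Fin n) → Set
InducedCycle G k c =
  Injective _≡_ _≡_ c × (∀ i j → Adj G (c i) (c j) ⇔ CyclicAdj (4 + k) i j)

Chordal : {n : ℕ} → Graph n → Set
Chordal {n} G = ∀ (k : ℕ) (c : Fin (4 + k) → Fin n) → ¬ InducedCycle G k c

Independent : {n : ℕ} → Graph n → Subset n → Set
Independent G S = ∀ u v → u ∈ S → v ∈ S → ¬ Adj G u v

IsIndependenceNumber : {n : ℕ} → Graph n → ℕ → Set
IsIndependenceNumber {n} G a =
  (Σ (Subset n) λ S → Independent G S × ∣ S ∣ ≡ a) ×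
  (∀ (S : Subset n) → Independent G S → ∣ S ∣ ≤ a)

Complex : ℕ → Set₁
Complex n = Subset n → Set

nbhd : {n : ℕ} → Graph n → Fin n → Subset n
nbhd G v = tabulate (λ u → if adj G v u then inside else outside)

NeighborhoodComplex : {n : ℕ} → Graph n → Complex n
NeighborhoodComplex {n} H σ = ∃ λ (v : Fin n) → σ ⊆ nbhd H v

FreeFace : {n : ℕ} → Complex n → Subset n → Set
FreeFace {n} X σ = X σ × (Σ (Subset n) λ τ → X τ × σ ⊂ τ ×
  (∀ ρ → X ρ → σ ⊆ ρ → (ρ ≡ σ) ⊎ (ρ ≡ τ)))

ElementaryCollapse : {n : ℕ} → Complex n → Complex n → Set
ElementaryCollapse {n} X Y = Σ (Subset n) λ σ → FreeFace X σ ×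
  (∀ ρ → Y ρ ⇔ (X ρ × ¬ (σ ⊆ ρ)))

data Collapses {n : ℕ} : Complex n → Complex n → Set₁ where
  done : ∀ {X Y} → (∀ ρ → X ρ ⇔ Y ρ) → Collapses X Y
  step : ∀ {X Z Y} → ElementaryCollapse X Z → Collapses Z Y → Collapses X Y

-- Y (on vertices Fin n) is isomorphic to Z (on vertices Fin m): there is an
-- injective vertex map f : Fin m → Fin n whose induced map on faces is a
-- bijection from Z onto Y.
Image : {m n : ℕ} → (Fin m → Fin n) → Subset m → Subset n → Set
Image {m} {n} f τ σ = ∀ (u : Fin n) → u ∈ σ ⇔ (∃ λ (x : Fin m) → x ∈ τ × f x ≡ u)

IsomorphicTo : {n m : ℕ} → Complex n → Complex m → Set
IsomorphicTo {n} {m} Y Z = Σ (Fin m → Fin n) λ f → Injective _≡_ _≡_ f ×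
  (∀ σ → Y σ ⇔ (Σ (Subset m) λ τ → Z τ × Image f τ σ))

module Submission where

-- Let s be a simplicial vertex of G[U]. The faces of 𝒩(Ḡ[U]) that meet N(s) pair off with their
-- unions with s, and removing the pairs with supersets first is a sequence of elementary collapses; what
-- is left is Δ(U ∖ N[s]) ∪ s ⋆ 𝒩(Ḡ[U ∖ N[s]]). By induction 𝒩(Ḡ[U ∖ N[s]]) collapses to the boundary
-- ∂Δ(A′) of the simplex on a maximum independent set A′ of G[U ∖ N[s]]; coning this collapse with s
-- and then collapsing Δ(U ∖ N[s]) onto Δ(A′) leaves ∂Δ(A′ ∪ {s}), and A′ ∪ {s} is a maximum independent
-- set of G[U] because N[s] ∩ U is a clique. Chordality supplies the simplicial vertices (Dirac): a
-- vertex x with a non-neighbour has a simplicial non-neighbour inside a component C of G[U ∖ N[x]],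
-- because the neighbours of x seeing C form a clique, since a chordless path through C between two
-- non-adjacent ones would close a hole with x. From U = V(G) one gets 𝒩(Ḡ) ↘ ∂Δ(A) with ∣A∣ = α(G),
-- and ∂Δ(A) ≅ 𝒩(K_α(G)).

open import Defs
open import Level using (Level)
open import Data.Nat as ℕ using (ℕ; zero; suc; _+_; _≤_; _<_; s≤s; NonZero)
import Data.Nat.Properties as ℕ
open import Data.Nat.DivMod using (_%_; m<n⇒m%n≡m; n%n≡0)
open import Data.Fin as Fin using (Fin; zero; suc; toℕ; _≟_)
import Data.Fin.Properties as Fin
open import Data.Fin.Properties using (any?; suc-injective)
open import Data.Fin.Subset hiding (⊥)
open import Data.Fin.Subset.Properties
open import Data.Fin.Subset.Induction using (⊂-wellFounded; ⊃-wellFounded; Acc; acc)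
open import Data.Vec as Vec using ([]; _∷_; here; there)
import Data.Vec.Properties as Vec
open import Data.Vec.Functional using () renaming (_∷_ to _∷ᶠ_)
open import Data.Bool using (true; false; if_then_else_)
import Data.Bool.Properties as Bool
import Data.Unit as Unit
open import Data.Empty using (⊥; ⊥-elim)
open import Data.Product as Product using (Σ; ∃; _×_; _,_; proj₁; proj₂)
open import Data.Sum as Sum using (_⊎_; inj₁; inj₂; [_,_]′)
open import Data.List using (List; []; _∷_; _++_; _∷ʳ_; map; lookup; length)
open import Data.List.Relation.Unary.Any using (here; there)
open import Data.List.Relation.Unary.All as All using (All; []; _∷_)
import Data.List.Relation.Unary.All.Properties as All
open import Data.List.Relation.Unary.AllPairs as AllPairs using (AllPairs; []; _∷_)
import Data.List.Relation.Unary.AllPairs.Properties as AllPairs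
open import Data.List.Relation.Unary.Linked using (Linked; []; [-]; _∷_)
open import Data.List.Membership.Propositional using () renaming (_∈_ to _∈ₗ_; _∉_ to _∉ₗ_)
open import Data.List.Membership.Propositional.Properties using (∈-map⁺; ∈-++⁺ˡ; ∈-++⁺ʳ; ∈-lookup)
open import Function.Base using (_∘_; case_of_)
open import Function.Bundles using (_⇔_; mk⇔; Equivalence)
open import Function.Construct.Identity using (⇔-id)
open import Function.Construct.Symmetry using (⇔-sym)
open import Function.Construct.Composition using (_⇔-∘_)
open import Function.Definitions using (Injective)
open import Relation.Nullary using (¬_; Dec; yes; no; contradiction; ¬?)
open import Relation.Nullary.Decidable using (does; dec-true; _×-dec_; _⊎-dec_)
open import Relation.Unary using (Pred; Decidable)
open import Relation.Binary.Definitions using (tri<; tri≈; tri>)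
open import Relation.Binary.PropositionalEquality

open Equivalence using (to; from)

private
  variable
    ℓ : Level
    n : ℕ

-- Finite subsets

module _ {P : Pred (Fin n) ℓ} (P? : Decidable P) where

  subset : Subset n
  subset = Vec.tabulate (λ x → does (P? x))

  ∈-subset⁺ : ∀ {x} → P x → x ∈ subset
  ∈-subset⁺ {x} px = Vec.lookup⇒[]= x subset (trans (Vec.lookup∘tabulate _ x) (dec-true (P? x) px))

  ∈-subset⁻ : ∀ {x} → x ∈ subset → P x
  ∈-subset⁻ {x} x∈ with P? x | trans (sym (Vec.lookup∘tabulate (λ y → does (P? y)) x)) (Vec.[]=⇒lookup x∈)
  ... | yes px | _  = px
  ... | no _   | ()

x∈p∪⁅y⁆⁻ : ∀ {p : Subset n} {x y} → x ∈ p ∪ ⁅ y ⁆ → x ∈ p ⊎ x ≡ y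
x∈p∪⁅y⁆⁻ {p = p} {y = y} x∈ with x∈p∪q⁻ p ⁅ y ⁆ x∈
... | inj₁ x∈p   = inj₁ x∈p
... | inj₂ x∈⁅y⁆ = inj₂ (x∈⁅y⁆⇒x≡y y x∈⁅y⁆)

x∈p-y⁻ : ∀ {p : Subset n} {x y} → x ∈ p - y → x ∈ p × x ≢ y
x∈p-y⁻ {p = p} {y = y} x∈ = p─q⊆p p ⁅ y ⁆ x∈ , λ { refl → ∉p─q (x∈⁅x⁆ y) x∈ }
  where
  ∉p─q : ∀ {m} {p q : Subset m} {z} → z ∈ q → z ∉ p ─ q
  ∉p─q {p = _ ∷ _} {inside ∷ _} here ()
  ∉p─q {p = _ ∷ _} {_ ∷ _} (there z∈q) (there z∈) = ∉p─q z∈q z∈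

x∈p⇒x≡y⊎x∈p-y : ∀ {p : Subset n} {x y} → x ∈ p → x ≡ y ⊎ x ∈ p - y
x∈p⇒x≡y⊎x∈p-y {x = x} {y = y} x∈p with x ≟ y
... | yes x≡y = inj₁ x≡y
... | no x≢y  = inj₂ (x∈p∧x≢y⇒x∈p-y x∈p x≢y)

p∪⁅y⁆⊆q : ∀ {p q : Subset n} {y} → p ⊆ q → y ∈ q → p ∪ ⁅ y ⁆ ⊆ q
p∪⁅y⁆⊆q p⊆q y∈q x∈ with x∈p∪⁅y⁆⁻ x∈
... | inj₁ x∈p = p⊆q x∈p
... | inj₂ refl = y∈q

p⊆q∪⁅y⁆⇒p-y⊆q : ∀ {p q : Subset n} {y} → p ⊆ q ∪ ⁅ y ⁆ → p - y ⊆ q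
p⊆q∪⁅y⁆⇒p-y⊆q p⊆ x∈ with x∈p-y⁻ x∈
... | x∈p , x≢y with x∈p∪⁅y⁆⁻ (p⊆ x∈p)
...   | inj₁ x∈q = x∈q
...   | inj₂ x≡y = contradiction x≡y x≢y

y∉p⇒p⊆q∪⁅y⁆⇒p⊆q : ∀ {p q : Subset n} {y} → y ∉ p → p ⊆ q ∪ ⁅ y ⁆ → p ⊆ q
y∉p⇒p⊆q∪⁅y⁆⇒p⊆q y∉p p⊆ x∈p =
  p⊆q∪⁅y⁆⇒p-y⊆q p⊆ (x∈p∧x≢y⇒x∈p-y x∈p λ { refl → y∉p x∈p })

p⊆p∪⁅y⁆ : ∀ {p : Subset n} y → p ⊆ p ∪ ⁅ y ⁆
p⊆p∪⁅y⁆ y = p⊆p∪q ⁅ y ⁆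

y∈p∪⁅y⁆ : ∀ {p : Subset n} y → y ∈ p ∪ ⁅ y ⁆
y∈p∪⁅y⁆ {p = p} y = q⊆p∪q p ⁅ y ⁆ (x∈⁅x⁆ y)

p∪⁅y⁆-mono : ∀ {p q : Subset n} y → p ⊆ q → p ∪ ⁅ y ⁆ ⊆ q ∪ ⁅ y ⁆
p∪⁅y⁆-mono y p⊆q = p∪⁅y⁆⊆q (λ x∈p → p⊆p∪⁅y⁆ y (p⊆q x∈p)) (y∈p∪⁅y⁆ y)

p-y∪⁅y⁆≡p : ∀ {p : Subset n} {y} → y ∈ p → (p - y) ∪ ⁅ y ⁆ ≡ p
p-y∪⁅y⁆≡p {y = y} y∈p =
  ⊆-antisym (p∪⁅y⁆⊆q (λ x∈ → proj₁ (x∈p-y⁻ x∈)) y∈p) (p⊆q∪⁅y⁆ ⊆-refl)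
  where
  p⊆q∪⁅y⁆ : ∀ {p q : Subset _} → p - y ⊆ q → p ⊆ q ∪ ⁅ y ⁆
  p⊆q∪⁅y⁆ p-y⊆q x∈p with x∈p⇒x≡y⊎x∈p-y {y = y} x∈p
  ... | inj₁ refl = y∈p∪⁅y⁆ y
  ... | inj₂ x∈p-y = p⊆p∪⁅y⁆ y (p-y⊆q x∈p-y)

p∪⁅y⁆-y≡p : ∀ {p : Subset n} {y} → y ∉ p → p ∪ ⁅ y ⁆ - y ≡ p
p∪⁅y⁆-y≡p {y = y} y∉p =
  ⊆-antisym (p⊆q∪⁅y⁆⇒p-y⊆q ⊆-refl)
            (λ x∈p → x∈p∧x≢y⇒x∈p-y (p⊆p∪⁅y⁆ y x∈p) λ { refl → y∉p x∈p })

∪⁅y⁆-cancel : ∀ {p q : Subset n} {y} → y ∉ p → y ∉ q → p ∪ ⁅ y ⁆ ≡ q ∪ ⁅ y ⁆ → p ≡ q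
∪⁅y⁆-cancel {p = p} {q} {y} y∉p y∉q eq = begin
  p              ≡⟨ p∪⁅y⁆-y≡p y∉p ⟨
  p ∪ ⁅ y ⁆ - y  ≡⟨ cong (_- y) eq ⟩
  q ∪ ⁅ y ⁆ - y  ≡⟨ p∪⁅y⁆-y≡p y∉q ⟩
  q              ∎
  where open ≡-Reasoning

∣p∪⁅y⁆∣≡1+∣p∣ : ∀ {p : Subset n} {y} → y ∉ p → ∣ p ∪ ⁅ y ⁆ ∣ ≡ suc ∣ p ∣
∣p∪⁅y⁆∣≡1+∣p∣ {p = inside ∷ p} {zero} y∉p = contradiction here y∉p
∣p∪⁅y⁆∣≡1+∣p∣ {p = outside ∷ p} {zero} y∉p = cong (λ q → suc ∣ q ∣) (∪-identityʳ p)
∣p∪⁅y⁆∣≡1+∣p∣ {p = inside ∷ p} {suc y} y∉p = cong suc (∣p∪⁅y⁆∣≡1+∣p∣ (λ y∈p → y∉p (there y∈p)))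
∣p∪⁅y⁆∣≡1+∣p∣ {p = outside ∷ p} {suc y} y∉p = ∣p∪⁅y⁆∣≡1+∣p∣ (λ y∈p → y∉p (there y∈p))

∣p∣≤1+∣q∣ : ∀ {p q : Subset n} {y} → p ⊆ q ∪ ⁅ y ⁆ → ∣ p ∣ ≤ suc ∣ q ∣
∣p∣≤1+∣q∣ {q = q} {y} p⊆ with y ∈? q
... | yes y∈q = ℕ.m≤n⇒m≤1+n (p⊆q⇒∣p∣≤∣q∣ (⊆-trans p⊆ (p∪⁅y⁆⊆q ⊆-refl y∈q)))
... | no y∉q  = ℕ.≤-trans (p⊆q⇒∣p∣≤∣q∣ p⊆) (ℕ.≤-reflexive (∣p∪⁅y⁆∣≡1+∣p∣ y∉q))

enumerate : (p : Subset n) → Fin ∣ p ∣ → Fin n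
enumerate (inside ∷ p) zero = zero
enumerate (inside ∷ p) (suc i) = suc (enumerate p i)
enumerate (outside ∷ p) i = suc (enumerate p i)

enumerate-∈ : ∀ (p : Subset n) i → enumerate p i ∈ p
enumerate-∈ (inside ∷ p) zero = here
enumerate-∈ (inside ∷ p) (suc i) = there (enumerate-∈ p i)
enumerate-∈ (outside ∷ p) i = there (enumerate-∈ p i)

enumerate-injective : ∀ (p : Subset n) → Injective _≡_ _≡_ (enumerate p)
enumerate-injective (inside ∷ p) {zero} {zero} _ = refl
enumerate-injective (inside ∷ p) {suc i} {suc j} eq =
  cong suc (enumerate-injective p (suc-injective eq))
enumerate-injective (outside ∷ p) eq = enumerate-injective p (suc-injective eq)

enumerate-surjective : ∀ (p : Subset n) {x} → x ∈ p → ∃ λ i → enumerate p i ≡ x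
enumerate-surjective (inside ∷ p) here = zero , refl
enumerate-surjective (inside ∷ p) (there x∈p) with enumerate-surjective p x∈p
... | i , refl = suc i , refl
enumerate-surjective (outside ∷ p) (there x∈p) with enumerate-surjective p x∈p
... | i , refl = i , refl

infix 4 _≟ₛ_

_≟ₛ_ : (p q : Subset n) → Dec (p ≡ q)
_≟ₛ_ = Vec.≡-dec Bool._≟_

1≤∣p∣⇒Nonempty : ∀ {p : Subset n} → 1 ≤ ∣ p ∣ → Nonempty p
1≤∣p∣⇒Nonempty {n} {p} 1≤∣p∣ with nonempty? p
... | yes p≠∅ = p≠∅
... | no p≡∅ with ℕ.≤-trans 1≤∣p∣ (ℕ.≤-reflexive (trans (cong ∣_∣ (Empty-unique p≡∅)) (∣⊥∣≡0 n)))
...   | ()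

∣p∣≤1+∣p∩q∣ : ∀ {p q : Subset n} → (∀ {x y} → x ∈ p → x ∉ q → y ∈ p → y ∉ q → x ≡ y) →
              ∣ p ∣ ≤ suc ∣ p ∩ q ∣
∣p∣≤1+∣p∩q∣ {p = p} {q} unique with any? (λ x → x ∈? p ×-dec ¬? (x ∈? q))
... | yes (t , t∈p , t∉q) = ∣p∣≤1+∣q∣ {y = t} p⊆p∩q∪t
  where
  p⊆p∩q∪t : p ⊆ p ∩ q ∪ ⁅ t ⁆
  p⊆p∩q∪t {x} x∈p with x ∈? q
  ... | yes x∈q = p⊆p∪⁅y⁆ t (x∈p∩q⁺ (x∈p , x∈q))
  ... | no x∉q rewrite unique x∈p x∉q t∈p t∉q = y∈p∪⁅y⁆ t
... | no none = ℕ.m≤n⇒m≤1+n (p⊆q⇒∣p∣≤∣q∣ p⊆p∩q)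
  where
  p⊆p∩q : p ⊆ p ∩ q
  p⊆p∩q {x} x∈p with x ∈? q
  ... | yes x∈q = x∈p∩q⁺ (x∈p , x∈q)
  ... | no x∉q = contradiction (x , x∈p , x∉q) none

-- Complexes and collapses

infix 4 _≋_

_≋_ : Complex n → Complex n → Set
X ≋ Y = ∀ ρ → X ρ ⇔ Y ρ

≋-sym : ∀ {X Y : Complex n} → X ≋ Y → Y ≋ X
≋-sym X≋Y ρ = ⇔-sym (X≋Y ρ)

≋-trans : ∀ {X Y Z : Complex n} → X ≋ Y → Y ≋ Z → X ≋ Z
≋-trans X≋Y Y≋Z ρ = Y≋Z ρ ⇔-∘ X≋Y ρ

≋-refl : ∀ {X : Complex n} → X ≋ X
≋-refl ρ = ⇔-id _

elementaryCollapse-respˡ-≋ : ∀ {X X' Y : Complex n} → X ≋ X' →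
                             ElementaryCollapse X Y → ElementaryCollapse X' Y
elementaryCollapse-respˡ-≋ X≋X' (σ , (Xσ , τ , Xτ , σ⊂τ , unique) , Y≋) =
  σ , (to (X≋X' σ) Xσ , τ , to (X≋X' τ) Xτ , σ⊂τ , λ ρ X'ρ → unique ρ (from (X≋X' ρ) X'ρ)) ,
  λ ρ → mk⇔ (λ Yρ → let Xρ , σ⊈ρ = to (Y≋ ρ) Yρ in to (X≋X' ρ) Xρ , σ⊈ρ)
            (λ (X'ρ , σ⊈ρ) → from (Y≋ ρ) (from (X≋X' ρ) X'ρ , σ⊈ρ))

elementaryCollapse-⊆ : ∀ {X Y : Complex n} → ElementaryCollapse X Y → ∀ {ρ} → Y ρ → X ρ
elementaryCollapse-⊆ (_ , _ , Y≋) Yρ = proj₁ (to (Y≋ _) Yρ)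

collapses-respˡ-≋ : ∀ {X X' Y : Complex n} → X ≋ X' → Collapses X Y → Collapses X' Y
collapses-respˡ-≋ X≋X' (done X≋Y) = done (≋-trans (≋-sym X≋X') X≋Y)
collapses-respˡ-≋ X≋X' (step c r) = step (elementaryCollapse-respˡ-≋ X≋X' c) r

collapses-respʳ-≋ : ∀ {X Y Y' : Complex n} → Collapses X Y → Y ≋ Y' → Collapses X Y'
collapses-respʳ-≋ (done X≋Y) Y≋Y' = done (≋-trans X≋Y Y≋Y')
collapses-respʳ-≋ (step c r) Y≋Y' = step c (collapses-respʳ-≋ r Y≋Y')

collapses-trans : ∀ {X Y Z : Complex n} → Collapses X Y → Collapses Y Z → Collapses X Z
collapses-trans (done X≋Y) r = collapses-respˡ-≋ (≋-sym X≋Y) r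
collapses-trans (step c r) r' = step c (collapses-trans r r')

allSubsets : ∀ n → List (Subset n)
allSubsets zero = [] ∷ []
allSubsets (suc n) = map (inside ∷_) (allSubsets n) ++ map (outside ∷_) (allSubsets n)

∈-allSubsets : ∀ (p : Subset n) → p ∈ₗ allSubsets n
∈-allSubsets [] = here refl
∈-allSubsets {suc n} (inside ∷ p) = ∈-++⁺ˡ (∈-map⁺ (inside ∷_) (∈-allSubsets p))
∈-allSubsets {suc n} (outside ∷ p) =
  ∈-++⁺ʳ (map (inside ∷_) (allSubsets n)) (∈-map⁺ (outside ∷_) (∈-allSubsets p))

allSubsets-supersetsFirst : ∀ n → AllPairs (λ p q → ¬ p ⊆ q) (allSubsets n)
allSubsets-supersetsFirst zero = All.[] ∷ []
allSubsets-supersetsFirst (suc n) =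
  AllPairs.++⁺ (prefixed inside) (prefixed outside)
               (All.map⁺ (All.universal (λ _ → All.map⁺ (All.universal (λ _ → in⊈out) _)) _))
  where
  prefixed : ∀ b → AllPairs (λ p q → ¬ p ⊆ q) (map (b ∷_) (allSubsets n))
  prefixed b = AllPairs.map⁺ (AllPairs.map ∷-⊈ (allSubsets-supersetsFirst n))
    where
    ∷-⊈ : ∀ {p q : Subset n} → ¬ p ⊆ q → ¬ b ∷ p ⊆ b ∷ q
    ∷-⊈ p⊈q b∷p⊆b∷q = p⊈q (drop-∷-⊆ b∷p⊆b∷q)
  in⊈out : ∀ {p q : Subset n} → ¬ inside ∷ p ⊆ outside ∷ q
  in⊈out ⊆ with ⊆ here
  ... | ()

InPair : Fin n → Subset n → Subset n → Set
InPair w π τ = τ ≡ π ⊎ τ ≡ π ∪ ⁅ w ⁆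

InPair⇒⊆ : ∀ {w} {π τ : Subset n} → InPair w π τ → π ⊆ τ
InPair⇒⊆ (inj₁ refl) = ⊆-refl
InPair⇒⊆ {w = w} (inj₂ refl) = p⊆p∪⁅y⁆ w

⊆-InPair : ∀ {w} {π π' τ : Subset n} → w ∉ π → π ⊆ τ → InPair w π' τ → π ⊆ π'
⊆-InPair _ π⊆τ (inj₁ refl) = π⊆τ
⊆-InPair w∉π π⊆τ (inj₂ refl) = y∉p⇒p⊆q∪⁅y⁆⇒p⊆q w∉π π⊆τ

InPair-⊆ : ∀ {w} {π τ W : Subset n} → π ⊆ W → w ∈ W → InPair w π τ → τ ⊆ W
InPair-⊆ π⊆W _ (inj₁ refl) = π⊆W
InPair-⊆ π⊆W w∈W (inj₂ refl) = p∪⁅y⁆⊆q π⊆W w∈W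

record ElementMatching (X : Complex n) (w : Fin n) : Set₁ where
  field
    Matched     : Subset n → Set
    matched?    : Decidable Matched
    w∉matched   : ∀ {π} → Matched π → w ∉ π
    matched∈    : ∀ {π} → Matched π → X π
    matched∪w∈  : ∀ {π} → Matched π → X (π ∪ ⁅ w ⁆)
    upwardClosed : ∀ {π τ} → Matched π → X τ → π ⊆ τ → ∃ λ π' → Matched π' × InPair w π' τ

module _ {X : Complex n} {w : Fin n} (M : ElementMatching X w) where
  open ElementMatching M

  Unmatched : Complex n
  Unmatched τ = X τ × ¬ (∃ λ π → Matched π × InPair w π τ)

  -- Stage l: the pairs of the matched π no longer in the list l of pending subsets have been removed.
  private
    Removed : List (Subset n) → Subset n → Set
    Removed l τ = ∃ λ π → Matched π × π ∉ₗ l × InPair w π τ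

    Stage : List (Subset n) → Complex n
    Stage l τ = X τ × ¬ Removed l τ

    Removed-∷ : ∀ {π l τ} → Removed (π ∷ l) τ → Removed l τ
    Removed-∷ (π' , Mπ' , π'∉ , π'τ) = π' , Mπ' , (λ π'∈l → π'∉ (there π'∈l)) , π'τ

    ∉-∷ : ∀ {π π' : Subset n} {l} → π' ≢ π → π' ∉ₗ l → π' ∉ₗ π ∷ l
    ∉-∷ π'≢π _ (here π'≡π) = π'≢π π'≡π
    ∉-∷ _ π'∉l (there π'∈l) = π'∉l π'∈l

    skipStage : ∀ {π l} → ¬ Matched π → Stage l ≋ Stage (π ∷ l)
    skipStage ¬Mπ ρ = mk⇔ (λ (Xρ , ¬removed) → Xρ , ¬removed ∘ Removed-∷)
                          (λ (Xρ , ¬removed) → Xρ , λ (π' , Mπ' , π'∉l , π'ρ) →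
                             ¬removed (π' , Mπ' , ∉-∷ (λ { refl → ¬Mπ Mπ' }) π'∉l , π'ρ))

    -- π is free: every other face containing it is π ∪ {w}, its supersets being matched earlier.
    module _ {π l} (Mπ : Matched π) (π⊈l : All (λ ρ → ¬ π ⊆ ρ) l) where

      w∉π : w ∉ π
      w∉π = w∉matched Mπ

      π∉l : π ∉ₗ l
      π∉l π∈l = All.lookup π⊈l π∈l ⊆-refl

      π∈stage : Stage (π ∷ l) π
      π∈stage = matched∈ Mπ , λ where
        (π' , _ , π'∉ , inj₁ refl) → π'∉ (here refl)
        (π' , _ , _ , inj₂ refl) → w∉π (y∈p∪⁅y⁆ w)

      π∪w∈stage : Stage (π ∷ l) (π ∪ ⁅ w ⁆)
      π∪w∈stage = matched∪w∈ Mπ , λ where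
        (π' , Mπ' , _ , inj₁ eq) → w∉matched Mπ' (subst (w ∈_) eq (y∈p∪⁅y⁆ w))
        (π' , Mπ' , π'∉ , inj₂ eq) → π'∉ (here (sym (∪⁅y⁆-cancel w∉π (w∉matched Mπ') eq)))

      cofaces : ∀ ρ → Stage (π ∷ l) ρ → π ⊆ ρ → InPair w π ρ
      cofaces ρ (Xρ , ¬removed) π⊆ρ with upwardClosed Mπ Xρ π⊆ρ
      ... | π' , Mπ' , π'ρ with π' ≟ₛ π
      ...   | yes refl = π'ρ
      ...   | no π'≢π = contradiction (π' , Mπ' , ∉-∷ π'≢π π'∉l , π'ρ) ¬removed
        where
        π'∉l : π' ∉ₗ l
        π'∉l π'∈l = All.lookup π⊈l π'∈l (⊆-InPair w∉π π⊆ρ π'ρ)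

      nextStage≋ : ∀ ρ → Stage l ρ ⇔ (Stage (π ∷ l) ρ × ¬ π ⊆ ρ)
      nextStage≋ ρ = mk⇔ shrink grow
        where
        shrink : Stage l ρ → Stage (π ∷ l) ρ × ¬ π ⊆ ρ
        shrink (Xρ , ¬removed) = stage , λ π⊆ρ → ¬removed (π , Mπ , π∉l , cofaces ρ stage π⊆ρ)
          where
          stage : Stage (π ∷ l) ρ
          stage = Xρ , ¬removed ∘ Removed-∷
        grow : Stage (π ∷ l) ρ × ¬ π ⊆ ρ → Stage l ρ
        grow ((Xρ , ¬removed) , π⊈ρ) = Xρ , λ (π' , Mπ' , π'∉l , π'ρ) → case π' ≟ₛ π of λ where
          (yes refl) → π⊈ρ (InPair⇒⊆ π'ρ)
          (no π'≢π) → ¬removed (π' , Mπ' , ∉-∷ π'≢π π'∉l , π'ρ)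

      removeStage : ElementaryCollapse (Stage (π ∷ l)) (Stage l)
      removeStage =
        π , (π∈stage , π ∪ ⁅ w ⁆ , π∪w∈stage , (p⊆p∪⁅y⁆ w , w , y∈p∪⁅y⁆ w , w∉π) , cofaces) , nextStage≋

    collapseStages : ∀ l → AllPairs (λ π ρ → ¬ π ⊆ ρ) l → Collapses (Stage l) (Stage [])
    collapseStages [] [] = done ≋-refl
    collapseStages (π ∷ l) (π⊈l ∷ ordered) with matched? π
    ... | yes Mπ = step (removeStage Mπ π⊈l) (collapseStages l ordered)
    ... | no ¬Mπ = collapses-respˡ-≋ (skipStage ¬Mπ) (collapseStages l ordered)

  collapse-matching : Collapses X Unmatched
  collapse-matching =
    collapses-respʳ-≋ (collapses-respˡ-≋ initial (collapseStages _ (allSubsets-supersetsFirst n))) final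
    where
    initial : Stage (allSubsets n) ≋ X
    initial ρ = mk⇔ proj₁ (λ Xρ → Xρ , λ (π , _ , π∉ , _) → π∉ (∈-allSubsets π))
    final : Stage [] ≋ Unmatched
    final ρ = mk⇔ (λ (Xρ , ¬removed) → Xρ , λ (π , Mπ , πρ) → ¬removed (π , Mπ , (λ ()) , πρ))
                  (λ (Xρ , ¬matched) → Xρ , λ (π , Mπ , _ , πρ) → ¬matched (π , Mπ , πρ))

Avoids : Complex n → Fin n → Set
Avoids X s = ∀ {ρ} → X ρ → s ∉ ρ

-- B ∪ s ⋆ X, for complexes B and X not using the vertex s.
Cone : Complex n → Fin n → Complex n → Complex n
Cone B s X ρ = B ρ ⊎ (s ∈ ρ × X (ρ - s))

module _ {B : Complex n} {s : Fin n} (s∉B : Avoids B s) where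

  cone-elementaryCollapse : ∀ {X Y} → Avoids X s → ElementaryCollapse X Y →
                            ElementaryCollapse (Cone B s X) (Cone B s Y)
  cone-elementaryCollapse {X} {Y} s∉X (σ , (Xσ , τ , Xτ , (σ⊆τ , x , x∈τ , x∉σ) , unique) , Y≋) =
    σ ∪ ⁅ s ⁆ , (apex Xσ , τ ∪ ⁅ s ⁆ , apex Xτ , (p∪⁅y⁆-mono s σ⊆τ , x , p⊆p∪⁅y⁆ s x∈τ , x∉σ∪s) , unique′) , Y≋′
    where
    apex : ∀ {ρ} → X ρ → Cone B s X (ρ ∪ ⁅ s ⁆)
    apex Xρ = inj₂ (y∈p∪⁅y⁆ s , subst X (sym (p∪⁅y⁆-y≡p (s∉X Xρ))) Xρ)
    x∉σ∪s : x ∉ σ ∪ ⁅ s ⁆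
    x∉σ∪s x∈ with x∈p∪⁅y⁆⁻ x∈
    ... | inj₁ x∈σ = x∉σ x∈σ
    ... | inj₂ refl = s∉X Xτ x∈τ
    σ⊆ρ-s : ∀ {ρ} → σ ∪ ⁅ s ⁆ ⊆ ρ → σ ⊆ ρ - s
    σ⊆ρ-s σ∪s⊆ρ y∈σ = x∈p∧x≢y⇒x∈p-y (σ∪s⊆ρ (p⊆p∪⁅y⁆ s y∈σ)) λ { refl → s∉X Xσ y∈σ }
    unique′ : ∀ ρ → Cone B s X ρ → σ ∪ ⁅ s ⁆ ⊆ ρ → ρ ≡ σ ∪ ⁅ s ⁆ ⊎ ρ ≡ τ ∪ ⁅ s ⁆
    unique′ ρ (inj₁ Bρ) σ∪s⊆ρ = contradiction (σ∪s⊆ρ (y∈p∪⁅y⁆ s)) (s∉B Bρ)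
    unique′ ρ (inj₂ (s∈ρ , Xρ-s)) σ∪s⊆ρ =
      Sum.map restore restore (unique (ρ - s) Xρ-s (σ⊆ρ-s σ∪s⊆ρ))
      where
      restore : ∀ {π} → ρ - s ≡ π → ρ ≡ π ∪ ⁅ s ⁆
      restore eq = trans (sym (p-y∪⁅y⁆≡p s∈ρ)) (cong (_∪ ⁅ s ⁆) eq)
    Y≋′ : ∀ ρ → Cone B s Y ρ ⇔ (Cone B s X ρ × ¬ σ ∪ ⁅ s ⁆ ⊆ ρ)
    Y≋′ ρ = mk⇔ shrink grow
      where
      shrink : Cone B s Y ρ → Cone B s X ρ × ¬ σ ∪ ⁅ s ⁆ ⊆ ρ
      shrink (inj₁ Bρ) = inj₁ Bρ , λ σ∪s⊆ρ → s∉B Bρ (σ∪s⊆ρ (y∈p∪⁅y⁆ s))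
      shrink (inj₂ (s∈ρ , Yρ-s)) =
        let Xρ-s , σ⊈ρ-s = to (Y≋ (ρ - s)) Yρ-s in inj₂ (s∈ρ , Xρ-s) , λ σ∪s⊆ρ → σ⊈ρ-s (σ⊆ρ-s σ∪s⊆ρ)
      grow : Cone B s X ρ × ¬ σ ∪ ⁅ s ⁆ ⊆ ρ → Cone B s Y ρ
      grow (inj₁ Bρ , _) = inj₁ Bρ
      grow (inj₂ (s∈ρ , Xρ-s) , σ∪s⊈ρ) =
        inj₂ (s∈ρ , from (Y≋ (ρ - s)) (Xρ-s , λ σ⊆ρ-s →
          σ∪s⊈ρ (p∪⁅y⁆⊆q (λ y∈σ → proj₁ (x∈p-y⁻ (σ⊆ρ-s y∈σ))) s∈ρ)))

  cone-collapses : ∀ {X Y} → Avoids X s → Collapses X Y → Collapses (Cone B s X) (Cone B s Y)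
  cone-collapses s∉X (done X≋Y) = done λ ρ → mk⇔ (Sum.map₂ (Product.map₂ (to (X≋Y _))))
                                                  (Sum.map₂ (Product.map₂ (from (X≋Y _))))
  cone-collapses s∉X (step c r) =
    step (cone-elementaryCollapse s∉X c) (cone-collapses (λ Zρ → s∉X (elementaryCollapse-⊆ c Zρ)) r)

Δ : Subset n → Complex n
Δ W ρ = ρ ⊆ W

Δ-mono : ∀ {W W' : Subset n} → W ⊆ W' → ∀ {ρ} → Δ W ρ → Δ W' ρ
Δ-mono W⊆W' ρ⊆W = ⊆-trans ρ⊆W W⊆W'

∂Δ : Subset n → Complex n
∂Δ A ρ = ρ ⊆ A × ∃ λ x → x ∈ A × x ∉ ρ

cone-∂Δ≋∂Δ : ∀ {A : Subset n} {s} → s ∉ A → Cone (Δ A) s (∂Δ A) ≋ ∂Δ (A ∪ ⁅ s ⁆)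
cone-∂Δ≋∂Δ {A = A} {s} s∉A τ = mk⇔ into back
  where
  into : Cone (Δ A) s (∂Δ A) τ → ∂Δ (A ∪ ⁅ s ⁆) τ
  into (inj₁ τ⊆A) = ⊆-trans τ⊆A (p⊆p∪⁅y⁆ s) , s , y∈p∪⁅y⁆ s , λ s∈τ → s∉A (τ⊆A s∈τ)
  into (inj₂ (s∈τ , τ-s⊆A , x , x∈A , x∉τ-s)) =
    ⊆-trans (⊆-reflexive (sym (p-y∪⁅y⁆≡p s∈τ))) (p∪⁅y⁆-mono s τ-s⊆A) , x , p⊆p∪⁅y⁆ s x∈A ,
    λ x∈τ → x∉τ-s (x∈p∧x≢y⇒x∈p-y x∈τ λ { refl → s∉A x∈A })
  back : ∂Δ (A ∪ ⁅ s ⁆) τ → Cone (Δ A) s (∂Δ A) τ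
  back (τ⊆A∪s , x , x∈A∪s , x∉τ) with s ∈? τ
  ... | no s∉τ = inj₁ (y∉p⇒p⊆q∪⁅y⁆⇒p⊆q s∉τ τ⊆A∪s)
  ... | yes s∈τ with x∈p∪⁅y⁆⁻ x∈A∪s
  ...   | inj₁ x∈A = inj₂ (s∈τ , p⊆q∪⁅y⁆⇒p-y⊆q τ⊆A∪s , x , x∈A , λ x∈τ-s → x∉τ (proj₁ (x∈p-y⁻ x∈τ-s)))
  ...   | inj₂ refl = contradiction s∈τ x∉τ

module _ {W A : Subset n} {s a} (s∉W : s ∉ W) (A⊆W : A ⊆ W) (a∈A : a ∈ A) where

  private
    Matched : Subset n → Set
    Matched ρ = ρ ⊆ W × ¬ ρ ⊆ A × a ∉ ρ

    pairUp : ∀ {τ} → τ ⊆ W → ¬ τ ⊆ A → ∃ λ π → Matched π × InPair a π τ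
    pairUp {τ} τ⊆W τ⊈A with a ∈? τ
    ... | no a∉τ = τ , (τ⊆W , τ⊈A , a∉τ) , inj₁ refl
    ... | yes a∈τ = τ - a , (⊆-trans (p─q⊆p τ ⁅ a ⁆) τ⊆W , τ-a⊈A , λ a∈τ-a → proj₂ (x∈p-y⁻ a∈τ-a) refl) ,
                    inj₂ (sym (p-y∪⁅y⁆≡p a∈τ))
      where
      τ-a⊈A : ¬ τ - a ⊆ A
      τ-a⊈A τ-a⊆A = τ⊈A (⊆-trans (⊆-reflexive (sym (p-y∪⁅y⁆≡p a∈τ))) (p∪⁅y⁆⊆q τ-a⊆A a∈A))

    upwardClosed : ∀ {π τ} → Matched π → Cone (Δ W) s (∂Δ A) τ → π ⊆ τ → ∃ λ π' → Matched π' × InPair a π' τ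
    upwardClosed (_ , π⊈A , _) (inj₁ τ⊆W) π⊆τ = pairUp τ⊆W λ τ⊆A → π⊈A (⊆-trans π⊆τ τ⊆A)
    upwardClosed (π⊆W , π⊈A , _) (inj₂ (_ , τ-s⊆A , _)) π⊆τ =
      contradiction (λ {_} x∈π → τ-s⊆A (x∈p∧x≢y⇒x∈p-y (π⊆τ x∈π) λ { refl → s∉W (π⊆W x∈π) })) π⊈A

  outsideA-matching : ElementMatching (Cone (Δ W) s (∂Δ A)) a
  outsideA-matching = record
    { Matched = Matched
    ; matched? = λ ρ → ρ ⊆? W ×-dec ¬? (ρ ⊆? A) ×-dec ¬? (a ∈? ρ)
    ; w∉matched = λ (_ , _ , a∉ρ) → a∉ρ
    ; matched∈ = λ (ρ⊆W , _) → inj₁ ρ⊆W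
    ; matched∪w∈ = λ (ρ⊆W , _) → inj₁ (p∪⁅y⁆⊆q ρ⊆W (A⊆W a∈A))
    ; upwardClosed = upwardClosed
    }

  unmatched-outsideA≋ : Unmatched outsideA-matching ≋ Cone (Δ A) s (∂Δ A)
  unmatched-outsideA≋ τ = mk⇔ into back
    where
    into : Unmatched outsideA-matching τ → Cone (Δ A) s (∂Δ A) τ
    into (inj₁ τ⊆W , unmatched) with τ ⊆? A
    ... | yes τ⊆A = inj₁ τ⊆A
    ... | no τ⊈A = contradiction (pairUp τ⊆W τ⊈A) unmatched
    into (inj₂ coned , _) = inj₂ coned
    back : Cone (Δ A) s (∂Δ A) τ → Unmatched outsideA-matching τ
    back (inj₁ τ⊆A) = inj₁ (⊆-trans τ⊆A A⊆W) , λ (π , (_ , π⊈A , _) , πτ) → π⊈A (⊆-trans (InPair⇒⊆ πτ) τ⊆A)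
    back (inj₂ coned@(s∈τ , _)) = inj₂ coned , λ (π , (π⊆W , _) , πτ) → s∉W (InPair-⊆ π⊆W (A⊆W a∈A) πτ s∈τ)

cone-Δ-collapses : ∀ {W A : Subset n} {s} → s ∉ W → A ⊆ W → (Nonempty W → Nonempty A) →
                   Collapses (Cone (Δ W) s (∂Δ A)) (Cone (Δ A) s (∂Δ A))
cone-Δ-collapses {W = W} {A} s∉W A⊆W A≢∅ with nonempty? A
... | yes (a , a∈A) = collapses-respʳ-≋ (collapse-matching (outsideA-matching s∉W A⊆W a∈A)) (unmatched-outsideA≋ s∉W A⊆W a∈A)
... | no A≡∅ = done λ τ → mk⇔ (Sum.map₁ (Δ-mono W⊆A)) (Sum.map₁ (Δ-mono A⊆W))
  where
  W⊆A : W ⊆ A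
  W⊆A x∈W = contradiction (A≢∅ (_ , x∈W)) A≡∅

-- Adjacency on a cycle

Follows : ℕ → ℕ → ℕ → Set
Follows N i j = suc i ≡ j ⊎ (suc i ≡ N × j ≡ 0)

suc%≡⇔Follows : ∀ {N} .{{_ : NonZero N}} (i j : Fin N) → (suc (toℕ i) % N ≡ toℕ j) ⇔ Follows N (toℕ i) (toℕ j)
suc%≡⇔Follows {N} i j = mk⇔ into back
  where
  into : suc (toℕ i) % N ≡ toℕ j → Follows N (toℕ i) (toℕ j)
  into eq with suc (toℕ i) ℕ.≟ N
  ... | yes i+1≡N = inj₂ (i+1≡N , trans (sym eq) (trans (cong (_% N) i+1≡N) (n%n≡0 N)))
  ... | no i+1≢N = inj₁ (trans (sym (m<n⇒m%n≡m (ℕ.≤∧≢⇒< (Fin.toℕ<n i) i+1≢N))) eq)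
  back : Follows N (toℕ i) (toℕ j) → suc (toℕ i) % N ≡ toℕ j
  back (inj₁ i+1≡j) = trans (m<n⇒m%n≡m (subst (_< N) (sym i+1≡j) (Fin.toℕ<n j))) i+1≡j
  back (inj₂ (i+1≡N , j≡0)) = trans (cong (_% N) i+1≡N) (trans (n%n≡0 N) (sym j≡0))

cyclicAdj⇔Follows : ∀ {k} (i j : Fin (4 + k)) →
                    CyclicAdj (4 + k) i j ⇔ (Follows (4 + k) (toℕ i) (toℕ j) ⊎ Follows (4 + k) (toℕ j) (toℕ i))
cyclicAdj⇔Follows i j = mk⇔ (Sum.map (to (suc%≡⇔Follows i j)) (to (suc%≡⇔Follows j i)))
                            (Sum.map (from (suc%≡⇔Follows i j)) (from (suc%≡⇔Follows j i)))

Consecutive : ℕ → ℕ → Set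
Consecutive i j = suc i ≡ j ⊎ suc j ≡ i

-- Collapsing along simplicial vertices; Dirac's lemma

module _ {n : ℕ} (G : Graph n) where

  adj? : ∀ u v → Dec (Adj G u v)
  adj? u v = adj G u v Bool.≟ true

  Adj-sym : ∀ {u v} → Adj G u v → Adj G v u
  Adj-sym {u} {v} u~v = trans (adj-sym G v u) u~v

  Adj-irrefl : ∀ {v} → ¬ Adj G v v
  Adj-irrefl {v} v~v with trans (sym v~v) (adj-irrefl G v)
  ... | ()

  Adj⇒≢ : ∀ {u v} → Adj G u v → u ≢ v
  Adj⇒≢ u~v refl = Adj-irrefl u~v

  NoEdge : Fin n → Subset n → Set
  NoEdge v = Lift (λ x → ¬ Adj G v x)

  Simplicial : Subset n → Fin n → Set
  Simplicial U s = ∀ {u v} → u ∈ U → v ∈ U → Adj G s u → Adj G s v → u ≢ v → Adj G u v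

  Near : Fin n → Fin n → Set
  Near u z = u ≡ z ⊎ Adj G u z

  Near? : ∀ u z → Dec (Near u z)
  Near? u z = (u ≟ z) ⊎-dec adj? u z

  Near⇒Adj : ∀ {u z} → Near u z → u ≢ z → Adj G u z
  Near⇒Adj (inj₁ u≡z) u≢z = contradiction u≡z u≢z
  Near⇒Adj (inj₂ u~z) _ = u~z

  Near-sym : ∀ {u z} → Near u z → Near z u
  Near-sym (inj₁ u≡z) = inj₁ (sym u≡z)
  Near-sym (inj₂ u~z) = inj₂ (Adj-sym u~z)

  infixl 8 _∖N[_]

  _∖N[_] : Subset n → Fin n → Subset n
  U ∖N[ s ] = subset (λ x → x ∈? U ×-dec ¬? (Near? s x))

  module _ {U : Subset n} {s : Fin n} where

    ∈∖N⁺ : ∀ {x} → x ∈ U → ¬ Near s x → x ∈ U ∖N[ s ]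
    ∈∖N⁺ x∈U s≁x = ∈-subset⁺ (λ x → x ∈? U ×-dec ¬? (Near? s x)) (x∈U , s≁x)

    ∈∖N⁻ : ∀ {x} → x ∈ U ∖N[ s ] → x ∈ U × ¬ Near s x
    ∈∖N⁻ = ∈-subset⁻ (λ x → x ∈? U ×-dec ¬? (Near? s x))

    ∖N⊆ : U ∖N[ s ] ⊆ U
    ∖N⊆ x∈ = proj₁ (∈∖N⁻ x∈)

    ∈∖N⇒≁ : ∀ {x} → x ∈ U ∖N[ s ] → ¬ Adj G s x
    ∈∖N⇒≁ x∈ s~x = proj₂ (∈∖N⁻ x∈) (inj₂ s~x)

    s∉∖N : s ∉ U ∖N[ s ]
    s∉∖N s∈ = proj₂ (∈∖N⁻ s∈) (inj₁ refl)

    ∉∖N⇒Near : ∀ {x} → x ∈ U → x ∉ U ∖N[ s ] → Near s x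
    ∉∖N⇒Near {x} x∈U x∉ with Near? s x
    ... | yes near = near
    ... | no ¬near = contradiction (∈∖N⁺ x∈U ¬near) x∉

    ∖N⊂ : s ∈ U → U ∖N[ s ] ⊂ U
    ∖N⊂ s∈U = ∖N⊆ , s , s∈U , s∉∖N

  -- The neighbourhood complex 𝒩(Ḡ[U]) of the complement of the induced subgraph G[U].
  CoNbhd : Subset n → Complex n
  CoNbhd U ρ = ρ ⊆ U × ∃ λ v → v ∈ U × v ∉ ρ × NoEdge v ρ

  CoNbhd? : ∀ U ρ → Dec (CoNbhd U ρ)
  CoNbhd? U ρ = ρ ⊆? U ×-dec any? λ v → v ∈? U ×-dec ¬? (v ∈? ρ) ×-dec Lift? (λ x → ¬? (adj? v x)) ρ

  CoNbhd-⊆ : ∀ {U ρ π} → π ⊆ ρ → CoNbhd U ρ → CoNbhd U π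
  CoNbhd-⊆ π⊆ρ (ρ⊆U , v , v∈U , v∉ρ , v≁ρ) =
    ⊆-trans π⊆ρ ρ⊆U , v , v∈U , (λ v∈π → v∉ρ (π⊆ρ v∈π)) , λ x∈π → v≁ρ (π⊆ρ x∈π)

  NoEdge-∪⁅⁆ : ∀ {v ρ s} → NoEdge v ρ → ¬ Adj G v s → NoEdge v (ρ ∪ ⁅ s ⁆)
  NoEdge-∪⁅⁆ v≁ρ v≁s x∈ with x∈p∪⁅y⁆⁻ x∈
  ... | inj₁ x∈ρ = v≁ρ x∈ρ
  ... | inj₂ refl = v≁s

  module _ {U : Subset n} {s : Fin n} (s∈U : s ∈ U) where

    coNbhd-missing-N≋cone : (λ τ → CoNbhd U τ × NoEdge s τ) ≋ Cone (Δ (U ∖N[ s ])) s (CoNbhd (U ∖N[ s ]))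
    coNbhd-missing-N≋cone τ = mk⇔ into back
      where
      into : CoNbhd U τ × NoEdge s τ → Cone (Δ (U ∖N[ s ])) s (CoNbhd (U ∖N[ s ])) τ
      into ((τ⊆U , v , v∈U , v∉τ , v≁τ) , s≁τ) with s ∈? τ
      ... | no s∉τ = inj₁ λ x∈τ → ∈∖N⁺ (τ⊆U x∈τ) [ (λ { refl → s∉τ x∈τ }) , s≁τ x∈τ ]′
      ... | yes s∈τ = inj₂ (s∈τ , τ-s⊆W , v , ∈∖N⁺ v∈U [ (λ { refl → v∉τ s∈τ }) , (λ s~v → v≁τ s∈τ (Adj-sym s~v)) ]′ ,
                             (λ v∈τ-s → v∉τ (proj₁ (x∈p-y⁻ v∈τ-s))) , λ x∈τ-s → v≁τ (proj₁ (x∈p-y⁻ x∈τ-s)))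
        where
        τ-s⊆W : τ - s ⊆ U ∖N[ s ]
        τ-s⊆W x∈τ-s = let x∈τ , x≢s = x∈p-y⁻ x∈τ-s in ∈∖N⁺ (τ⊆U x∈τ) [ (λ s≡x → x≢s (sym s≡x)) , s≁τ x∈τ ]′
      back : Cone (Δ (U ∖N[ s ])) s (CoNbhd (U ∖N[ s ])) τ → CoNbhd U τ × NoEdge s τ
      back (inj₁ τ⊆W) = (⊆-trans τ⊆W ∖N⊆ , s , s∈U , (λ s∈τ → s∉∖N (τ⊆W s∈τ)) , s≁τ) , s≁τ
        where
        s≁τ : NoEdge s τ
        s≁τ x∈τ = ∈∖N⇒≁ (τ⊆W x∈τ)
      back (inj₂ (s∈τ , τ-s⊆W , v , v∈W , v∉τ-s , v≁τ-s)) with ∈∖N⁻ v∈W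
      ... | v∈U , s≁v = (τ⊆U , v , v∈U , v∉τ , v≁τ) , s≁τ
        where
        τ⊆U : τ ⊆ U
        τ⊆U x∈τ = [ (λ { refl → s∈U }) , (λ x∈τ-s → ∖N⊆ (τ-s⊆W x∈τ-s)) ]′ (x∈p⇒x≡y⊎x∈p-y x∈τ)
        v∉τ : v ∉ τ
        v∉τ v∈τ = [ (λ v≡s → s≁v (inj₁ (sym v≡s))) , v∉τ-s ]′ (x∈p⇒x≡y⊎x∈p-y v∈τ)
        v≁τ : NoEdge v τ
        v≁τ x∈τ = [ (λ { refl v~s → s≁v (inj₂ (Adj-sym v~s)) }) , v≁τ-s ]′ (x∈p⇒x≡y⊎x∈p-y x∈τ)
        s≁τ : NoEdge s τ
        s≁τ x∈τ = [ (λ { refl → Adj-irrefl }) , (λ x∈τ-s → ∈∖N⇒≁ (τ-s⊆W x∈τ-s)) ]′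
                  (x∈p⇒x≡y⊎x∈p-y x∈τ)

    module _ (simplicial : Simplicial U s) where

      private
        Meets : Subset n → Set
        Meets ρ = ∃ λ x → x ∈ ρ × Adj G s x

        Matched : Subset n → Set
        Matched ρ = CoNbhd U ρ × Meets ρ × s ∉ ρ

        pairUp : ∀ {τ} → CoNbhd U τ → Meets τ → ∃ λ π → Matched π × InPair s π τ
        pairUp {τ} τ∈ (x , x∈τ , s~x) with s ∈? τ
        ... | no s∉τ = τ , (τ∈ , (x , x∈τ , s~x) , s∉τ) , inj₁ refl
        ... | yes s∈τ = τ - s , (CoNbhd-⊆ (p─q⊆p τ ⁅ s ⁆) τ∈ , (x , x∈τ-s , s~x) , λ s∈τ-s → proj₂ (x∈p-y⁻ s∈τ-s) refl) ,
                        inj₂ (sym (p-y∪⁅y⁆≡p s∈τ))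
          where
          x∈τ-s : x ∈ τ - s
          x∈τ-s = x∈p∧x≢y⇒x∈p-y x∈τ λ { refl → Adj-irrefl s~x }

        -- The witness v of ρ still works for ρ ∪ {s}: v ≁ x for a neighbour x of s, so v ≁ s as s is simplicial.
        matched∪s∈ : ∀ {ρ} → Matched ρ → CoNbhd U (ρ ∪ ⁅ s ⁆)
        matched∪s∈ {ρ} ((ρ⊆U , v , v∈U , v∉ρ , v≁ρ) , (x , x∈ρ , s~x) , _) =
          p∪⁅y⁆⊆q ρ⊆U s∈U , v , v∈U , v∉ρ∪s , NoEdge-∪⁅⁆ v≁ρ v≁s
          where
          v≢s : v ≢ s
          v≢s refl = v≁ρ x∈ρ s~x
          v≁s : ¬ Adj G v s
          v≁s v~s = v≁ρ x∈ρ (simplicial v∈U (ρ⊆U x∈ρ) (Adj-sym v~s) s~x λ { refl → v∉ρ x∈ρ })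
          v∉ρ∪s : v ∉ ρ ∪ ⁅ s ⁆
          v∉ρ∪s v∈ = [ v∉ρ , v≢s ]′ (x∈p∪⁅y⁆⁻ v∈)

      meetingN-matching : ElementMatching (CoNbhd U) s
      meetingN-matching = record
        { Matched = Matched
        ; matched? = λ ρ → CoNbhd? U ρ ×-dec any? (λ x → x ∈? ρ ×-dec adj? s x) ×-dec ¬? (s ∈? ρ)
        ; w∉matched = λ (_ , _ , s∉ρ) → s∉ρ
        ; matched∈ = proj₁
        ; matched∪w∈ = matched∪s∈
        ; upwardClosed = λ (_ , (x , x∈π , s~x) , _) τ∈ π⊆τ → pairUp τ∈ (x , π⊆τ x∈π , s~x)
        }

      unmatched-meetingN≋ : Unmatched meetingN-matching ≋ λ τ → CoNbhd U τ × NoEdge s τ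
      unmatched-meetingN≋ τ =
        mk⇔ (λ (τ∈ , unmatched) → τ∈ , λ x∈τ s~x → unmatched (pairUp τ∈ (_ , x∈τ , s~x)))
            (λ (τ∈ , s≁τ) → τ∈ , λ (π , (_ , (x , x∈π , s~x) , _) , πτ) → s≁τ (InPair⇒⊆ πτ x∈π) s~x)

      collapse-N[s] : Collapses (CoNbhd U) (Cone (Δ (U ∖N[ s ])) s (CoNbhd (U ∖N[ s ])))
      collapse-N[s] = collapses-respʳ-≋ (collapse-matching meetingN-matching)
                                        (≋-trans unmatched-meetingN≋ coNbhd-missing-N≋cone)

  Independent-⊆ : ∀ {S T} → S ⊆ T → Independent G T → Independent G S
  Independent-⊆ S⊆T T-indep u v u∈S v∈S = T-indep u v (S⊆T u∈S) (S⊆T v∈S)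

  Independent-⁅⁆ : ∀ x → Independent G ⁅ x ⁆
  Independent-⁅⁆ x u v u∈ v∈ rewrite x∈⁅y⁆⇒x≡y x u∈ | x∈⁅y⁆⇒x≡y x v∈ = Adj-irrefl

  record BoundaryCollapse (U : Subset n) : Set₁ where
    field
      A           : Subset n
      A⊆U         : A ⊆ U
      independent : Independent G A
      maximum     : ∀ I → I ⊆ U → Independent G I → ∣ I ∣ ≤ ∣ A ∣
      collapse    : Collapses (CoNbhd U) (∂Δ A)

  boundaryCollapse-∅ : ∀ {U} → Empty U → BoundaryCollapse U
  boundaryCollapse-∅ {U} U≡∅ = record
    { A = U
    ; A⊆U = ⊆-refl
    ; independent = λ u _ u∈U → contradiction (u , u∈U) U≡∅
    ; maximum = λ I I⊆U _ → p⊆q⇒∣p∣≤∣q∣ I⊆U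
    ; collapse = done λ ρ → mk⇔ (λ (_ , v , v∈U , _) → contradiction (v , v∈U) U≡∅)
                                (λ (_ , x , x∈U , _) → contradiction (x , x∈U) U≡∅)
    }

  module _ {U : Subset n} {s : Fin n} (s∈U : s ∈ U) (simplicial : Simplicial U s) where

    -- N[s] ∩ U is a clique, so it meets an independent set at most once.
    independent-N[s]-unique : ∀ {I} → I ⊆ U → Independent G I →
                             ∀ {x y} → x ∈ I → x ∉ U ∖N[ s ] → y ∈ I → y ∉ U ∖N[ s ] → x ≡ y
    independent-N[s]-unique {I} I⊆U I-indep {x} {y} x∈I x∉ y∈I y∉ with x ≟ y
    ... | yes x≡y = x≡y
    ... | no x≢y with ∉∖N⇒Near (I⊆U x∈I) x∉ | ∉∖N⇒Near (I⊆U y∈I) y∉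
    ...   | inj₁ refl | inj₁ refl = contradiction refl x≢y
    ...   | inj₁ refl | inj₂ s~y  = contradiction s~y (I-indep x y x∈I y∈I)
    ...   | inj₂ s~x  | inj₁ refl = contradiction s~x (I-indep y x y∈I x∈I)
    ...   | inj₂ s~x  | inj₂ s~y  = contradiction (simplicial (I⊆U x∈I) (I⊆U y∈I) s~x s~y x≢y) (I-indep x y x∈I y∈I)

    extend : BoundaryCollapse (U ∖N[ s ]) → BoundaryCollapse U
    extend r = record
      { A = A ∪ ⁅ s ⁆
      ; A⊆U = p∪⁅y⁆⊆q (⊆-trans A⊆U ∖N⊆) s∈U
      ; independent = independent′
      ; maximum = maximum′
      ; collapse = collapse′
      }
      where
      open BoundaryCollapse r
      s∉A : s ∉ A
      s∉A s∈A = s∉∖N (A⊆U s∈A)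
      A-nonempty : Nonempty (U ∖N[ s ]) → Nonempty A
      A-nonempty (w , w∈W) = 1≤∣p∣⇒Nonempty (subst (_≤ ∣ A ∣) (∣⁅x⁆∣≡1 w) (maximum ⁅ w ⁆ ⁅w⁆⊆W (Independent-⁅⁆ w)))
        where
        ⁅w⁆⊆W : ⁅ w ⁆ ⊆ U ∖N[ s ]
        ⁅w⁆⊆W x∈ rewrite x∈⁅y⁆⇒x≡y w x∈ = w∈W
      s∉Δ : Avoids (Δ (U ∖N[ s ])) s
      s∉Δ ρ⊆W s∈ρ = s∉∖N (ρ⊆W s∈ρ)
      collapse′ : Collapses (CoNbhd U) (∂Δ (A ∪ ⁅ s ⁆))
      collapse′ =
        collapses-trans (collapse-N[s] s∈U simplicial) (
        collapses-trans (cone-collapses s∉Δ (s∉Δ ∘ proj₁) collapse) (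
        collapses-respʳ-≋ (cone-Δ-collapses s∉∖N A⊆U A-nonempty) (cone-∂Δ≋∂Δ s∉A)))
      independent′ : Independent G (A ∪ ⁅ s ⁆)
      independent′ u v u∈ v∈ with x∈p∪⁅y⁆⁻ u∈ | x∈p∪⁅y⁆⁻ v∈
      ... | inj₁ u∈A | inj₁ v∈A = independent u v u∈A v∈A
      ... | inj₁ u∈A | inj₂ refl = λ u~s → ∈∖N⇒≁ (A⊆U u∈A) (Adj-sym u~s)
      ... | inj₂ refl | inj₁ v∈A = ∈∖N⇒≁ (A⊆U v∈A)
      ... | inj₂ refl | inj₂ refl = Adj-irrefl
      maximum′ : ∀ I → I ⊆ U → Independent G I → ∣ I ∣ ≤ ∣ A ∪ ⁅ s ⁆ ∣
      maximum′ I I⊆U I-indep = begin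
        ∣ I ∣                      ≤⟨ ∣p∣≤1+∣p∩q∣ (independent-N[s]-unique I⊆U I-indep) ⟩
        suc ∣ I ∩ U ∖N[ s ] ∣      ≤⟨ s≤s (maximum (I ∩ U ∖N[ s ]) (p∩q⊆q I _) (Independent-⊆ (p∩q⊆p I _) I-indep)) ⟩
        suc ∣ A ∣                  ≡⟨ ∣p∪⁅y⁆∣≡1+∣p∣ s∉A ⟨
        ∣ A ∪ ⁅ s ⁆ ∣              ∎
        where open ℕ.≤-Reasoning

  boundaryCollapse : (∀ U → Nonempty U → ∃ λ s → s ∈ U × Simplicial U s) → ∀ U → BoundaryCollapse U
  boundaryCollapse simplicialVertex U = go U (⊂-wellFounded U)
    where
    go : ∀ U → Acc _⊂_ U → BoundaryCollapse U
    go U (acc smaller) with nonempty? U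
    ... | no U≡∅ = boundaryCollapse-∅ U≡∅
    ... | yes U≠∅ with simplicialVertex U U≠∅
    ...   | s , s∈U , simplicial = extend s∈U simplicial (go (U ∖N[ s ]) (smaller (∖N⊂ s∈U)))

  IsInducedPath : ∀ {m} → (Fin m → Fin n) → Set
  IsInducedPath p = Injective _≡_ _≡_ p × (∀ i j → Adj G (p i) (p j) ⇔ Consecutive (toℕ i) (toℕ j))

  closeCycle : ∀ {k x} {p : Fin (3 + k) → Fin n} → IsInducedPath p → (∀ j → x ≢ p j) →
               (∀ j → Adj G x (p j) ⇔ (toℕ j ≡ 0 ⊎ toℕ j ≡ 2 + k)) → InducedCycle G k (x ∷ᶠ p)
  closeCycle {k} {x} {p} (p-injective , p-adj) x∉p x-adj = injective , λ i j → ⇔-sym (cyclicAdj⇔Follows i j) ⇔-∘ adjacency i j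
    where
    N : ℕ
    N = 4 + k
    injective : Injective _≡_ _≡_ (x ∷ᶠ p)
    injective {zero} {zero} _ = refl
    injective {zero} {suc j} x≡pj = contradiction x≡pj (x∉p j)
    injective {suc i} {zero} pi≡x = contradiction (sym pi≡x) (x∉p i)
    injective {suc i} {suc j} pi≡pj = cong suc (p-injective pi≡pj)
    attach : ∀ j → (toℕ j ≡ 0 ⊎ toℕ j ≡ 2 + k) ⇔ (Follows N 0 (toℕ (suc j)) ⊎ Follows N (toℕ (suc j)) 0)
    attach j = mk⇔ (Sum.map (λ j≡0 → inj₁ (cong suc (sym j≡0))) (λ j≡2+k → inj₂ (cong (λ m → suc (suc m)) j≡2+k , refl)))
                   (λ { (inj₁ (inj₁ eq)) → inj₁ (sym (ℕ.suc-injective eq))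
                      ; (inj₂ (inj₂ (eq , _))) → inj₂ (ℕ.suc-injective (ℕ.suc-injective eq))
                      ; (inj₁ (inj₂ (() , _))) ; (inj₂ (inj₁ ())) })
    adjacency : ∀ i j → Adj G ((x ∷ᶠ p) i) ((x ∷ᶠ p) j) ⇔ (Follows N (toℕ i) (toℕ j) ⊎ Follows N (toℕ j) (toℕ i))
    adjacency zero zero = mk⇔ (λ x~x → contradiction x~x Adj-irrefl) λ { (inj₁ (inj₁ ())) ; (inj₂ (inj₁ ())) }
    adjacency zero (suc j) = attach j ⇔-∘ x-adj j
    adjacency (suc i) zero = mk⇔ Sum.swap Sum.swap ⇔-∘ (attach i ⇔-∘ (x-adj i ⇔-∘ mk⇔ Adj-sym Adj-sym))
    adjacency (suc i) (suc j) = inner ⇔-∘ p-adj i j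
      where
      inner : Consecutive (toℕ i) (toℕ j) ⇔ (Follows N (toℕ (suc i)) (toℕ (suc j)) ⊎ Follows N (toℕ (suc j)) (toℕ (suc i)))
      inner = mk⇔ (Sum.map (λ eq → inj₁ (cong suc eq)) (λ eq → inj₁ (cong suc eq)))
                  (λ { (inj₁ (inj₁ eq)) → inj₁ (ℕ.suc-injective eq) ; (inj₂ (inj₁ eq)) → inj₂ (ℕ.suc-injective eq)
                     ; (inj₁ (inj₂ (_ , ()))) ; (inj₂ (inj₂ (_ , ()))) })

  ChordlessPath : List (Fin n) → Set
  ChordlessPath [] = Unit.⊤
  ChordlessPath (u ∷ []) = Unit.⊤
  ChordlessPath (u ∷ v ∷ r) = Adj G u v × All (¬_ ∘ Near u) r × ChordlessPath (v ∷ r)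

  chordlessPath-suffix : ∀ ys {zs} → ChordlessPath (ys ++ zs) → ChordlessPath zs
  chordlessPath-suffix [] chordless = chordless
  chordlessPath-suffix (y ∷ []) {[]} _ = Unit.tt
  chordlessPath-suffix (y ∷ []) {z ∷ zs} (_ , _ , chordless) = chordless
  chordlessPath-suffix (y ∷ y′ ∷ ys) (_ , _ , chordless) = chordlessPath-suffix (y′ ∷ ys) chordless

  chordlessPath-ordered : ∀ p → ChordlessPath p → ∀ i j → i Fin.< j →
                          (Adj G (lookup p i) (lookup p j) ⇔ toℕ j ≡ suc (toℕ i)) × lookup p i ≢ lookup p j
  chordlessPath-ordered (u ∷ v ∷ r) (u~v , _ , _) zero (suc zero) _ =
    mk⇔ (λ _ → refl) (λ _ → u~v) , Adj⇒≢ u~v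
  chordlessPath-ordered (u ∷ v ∷ r) (_ , far , _) zero (suc (suc j)) _ =
    mk⇔ (λ u~z → contradiction (inj₂ u~z) u≁z) (λ ()) , λ u≡z → u≁z (inj₁ u≡z)
    where
    u≁z : ¬ Near u (lookup r j)
    u≁z = All.lookup far (∈-lookup j)
  chordlessPath-ordered (u ∷ v ∷ r) (_ , _ , chordless) (suc i) (suc j) (s≤s i<j) =
    let adj⇔ , distinct = chordlessPath-ordered (v ∷ r) chordless i j i<j
    in mk⇔ (cong suc ∘ to adj⇔) (from adj⇔ ∘ ℕ.suc-injective) , distinct

  chordlessPath⇒isInducedPath : ∀ p → ChordlessPath p → IsInducedPath (lookup p)
  chordlessPath⇒isInducedPath p chordless = injective , adjacency
    where
    ordered : ∀ i j → i Fin.< j → (Adj G (lookup p i) (lookup p j) ⇔ toℕ j ≡ suc (toℕ i)) × lookup p i ≢ lookup p j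
    ordered = chordlessPath-ordered p chordless
    injective : Injective _≡_ _≡_ (lookup p)
    injective {i} {j} eq with Fin.<-cmp i j
    ... | tri< i<j _ _ = contradiction eq (proj₂ (ordered i j i<j))
    ... | tri≈ _ i≡j _ = i≡j
    ... | tri> _ _ j<i = contradiction (sym eq) (proj₂ (ordered j i j<i))
    fromOrdered : ∀ {A : Set} {a b} → a ℕ.< b → A ⇔ (b ≡ suc a) → A ⇔ Consecutive a b
    fromOrdered a<b A⇔ = mk⇔ (inj₁ ∘ sym ∘ to A⇔)
                             [ from A⇔ ∘ sym , (λ b+1≡a → contradiction (ℕ.≤-reflexive b+1≡a) (ℕ.<-asym a<b)) ]′
    adjacency : ∀ i j → Adj G (lookup p i) (lookup p j) ⇔ Consecutive (toℕ i) (toℕ j)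
    adjacency i j with Fin.<-cmp i j
    ... | tri< i<j _ _ = fromOrdered i<j (proj₁ (ordered i j i<j))
    ... | tri≈ _ refl _ = mk⇔ (λ pi~pi → contradiction pi~pi Adj-irrefl) λ { (inj₁ eq) → contradiction eq ℕ.1+n≢n ; (inj₂ eq) → contradiction eq ℕ.1+n≢n }
    ... | tri> _ _ j<i =
      mk⇔ Sum.swap Sum.swap ⇔-∘ (fromOrdered j<i (proj₁ (ordered j i j<i)) ⇔-∘ mk⇔ Adj-sym Adj-sym)

  lastOf : Fin n → List (Fin n) → Fin n
  lastOf u [] = u
  lastOf _ (v ∷ l) = lastOf v l

  lastOf-++ : ∀ u ys z zs → lastOf u (ys ++ z ∷ zs) ≡ lastOf z zs
  lastOf-++ u [] z zs = refl
  lastOf-++ u (y ∷ ys) z zs = lastOf-++ y ys z zs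

  lastNear : ∀ u l → (∃ λ ys → ∃ λ z → ∃ λ zs → l ≡ ys ++ z ∷ zs × Near u z × All (¬_ ∘ Near u) zs)
                     ⊎ All (¬_ ∘ Near u) l
  lastNear u [] = inj₂ []
  lastNear u (t ∷ l) with lastNear u l
  ... | inj₁ (ys , z , zs , refl , near , far) = inj₁ (t ∷ ys , z , zs , refl , near , far)
  ... | inj₂ far with Near? u t
  ...   | yes near = inj₁ ([] , t , l , refl , near , far)
  ...   | no ¬near = inj₂ (¬near ∷ far)

  record Shortcut (u : Fin n) (l : List (Fin n)) : Set where
    field
      path      : List (Fin n)
      chordless : ChordlessPath (u ∷ path)
      sameEnd   : lastOf u path ≡ lastOf u l
      ⊆-walk    : ∀ {z} → z ∈ₗ path → z ∈ₗ l

  -- Attach u to the last vertex of the chordless path that equals or is adjacent to u.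
  prepend : ∀ {u v l} → Adj G u v → Shortcut v l → Shortcut u (v ∷ l)
  prepend {u} {v} {l} u~v S with lastNear u (v ∷ Shortcut.path S)
  ... | inj₂ (¬near ∷ _) = contradiction (inj₂ u~v) ¬near
  ... | inj₁ (ys , z , zs , eq , near , far) = attach near
    where
    open Shortcut S using (path; chordless; sameEnd; ⊆-walk)
    suffix-chordless : ChordlessPath (z ∷ zs)
    suffix-chordless = chordlessPath-suffix ys (subst ChordlessPath eq chordless)
    suffix-end : lastOf z zs ≡ lastOf v l
    suffix-end = trans (sym (trans (cong (lastOf u) eq) (lastOf-++ u ys z zs))) sameEnd
    suffix-⊆ : ∀ {t} → t ∈ₗ z ∷ zs → t ∈ₗ v ∷ l
    suffix-⊆ t∈ with subst (_ ∈ₗ_) (sym eq) (∈-++⁺ʳ ys t∈)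
    ... | here t≡v = here t≡v
    ... | there t∈path = there (⊆-walk t∈path)
    attach : Near u z → Shortcut u (v ∷ l)
    attach (inj₁ refl) = record { path = zs ; chordless = suffix-chordless ; sameEnd = suffix-end ; ⊆-walk = suffix-⊆ ∘ there }
    attach (inj₂ u~z) = record { path = z ∷ zs ; chordless = u~z , far , suffix-chordless ; sameEnd = suffix-end ; ⊆-walk = suffix-⊆ }

  shortcut : ∀ u l → Linked (Adj G) (u ∷ l) → Shortcut u l
  shortcut u [] _ = record { path = [] ; chordless = Unit.tt ; sameEnd = refl ; ⊆-walk = λ () }
  shortcut u (v ∷ l) (u~v ∷ walk) = prepend u~v (shortcut v l walk)

  lookup-last : ∀ a q → lookup (a ∷ q) (Fin.fromℕ (length q)) ≡ lastOf a q
  lookup-last a [] = refl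
  lookup-last a (v ∷ q) = lookup-last v q

  record WalkWithin (P : Fin n → Set) (u v : Fin n) : Set where
    field
      inner  : List (Fin n)
      walk   : Linked (Adj G) (u ∷ inner)
      ends   : lastOf u inner ≡ v
      within : All P inner

  lastOf-∷ʳ : ∀ u l {z} → lastOf u (l ∷ʳ z) ≡ z
  lastOf-∷ʳ u [] = refl
  lastOf-∷ʳ u (v ∷ l) = lastOf-∷ʳ v l

  module _ {P : Fin n → Set} where

    []ʷ : ∀ {u} → WalkWithin P u u
    []ʷ = record { inner = [] ; walk = [-] ; ends = refl ; within = [] }

    _◅_ : ∀ {u v w} → Adj G u v × P v → WalkWithin P v w → WalkWithin P u w
    (u~v , Pv) ◅ record { inner = l ; walk = walk ; ends = ends ; within = within } =
      record { inner = _ ∷ l ; walk = u~v ∷ walk ; ends = ends ; within = Pv ∷ within }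

    _▻_ : ∀ {u v w} → WalkWithin P u v → Adj G v w × P w → WalkWithin P u w
    _▻_ {u} record { inner = l ; walk = walk ; ends = refl ; within = within } (v~w , Pw) =
      record { inner = l ∷ʳ _ ; walk = snoc u l walk v~w ; ends = lastOf-∷ʳ u l ; within = All.++⁺ within (Pw ∷ []) }
      where
      snoc : ∀ u l {w} → Linked (Adj G) (u ∷ l) → Adj G (lastOf u l) w → Linked (Adj G) (u ∷ l ∷ʳ w)
      snoc u [] _ u~w = u~w ∷ [-]
      snoc u (v ∷ l) (u~v ∷ walk) last~w = u~v ∷ snoc v l walk last~w

  WalkWithin-map : ∀ {P Q : Fin n → Set} {u v} → (∀ {z} → P z → Q z) → WalkWithin P u v → WalkWithin Q u v
  WalkWithin-map P⇒Q record { inner = l ; walk = walk ; ends = ends ; within = within } =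
    record { inner = l ; walk = walk ; ends = ends ; within = All.map P⇒Q within }

  record Component (W : Subset n) (y : Fin n) : Set where
    field
      C         : Subset n
      C⊆W       : C ⊆ W
      y∈C       : y ∈ C
      closed    : ∀ {c z} → c ∈ C → z ∈ W → Adj G c z → z ∈ C
      connected : ∀ {c c'} → c ∈ C → c' ∈ C → WalkWithin (_∈ C) c c'

  module _ {W : Subset n} {y : Fin n} where

    private
      grow : ∀ C → Acc _⊃_ C → C ⊆ W → y ∈ C → (∀ {c c'} → c ∈ C → c' ∈ C → WalkWithin (_∈ C) c c') →
             Component W y
      grow C (acc larger) C⊆W y∈C connected
        with any? (λ z → z ∈? W ×-dec ¬? (z ∈? C) ×-dec any? (λ c → c ∈? C ×-dec adj? c z))
      ... | no none = record { C = C ; C⊆W = C⊆W ; y∈C = y∈C ; closed = closed ; connected = connected }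
        where
        closed : ∀ {c z} → c ∈ C → z ∈ W → Adj G c z → z ∈ C
        closed {c} {z} c∈C z∈W c~z with z ∈? C
        ... | yes z∈C = z∈C
        ... | no z∉C = contradiction (z , z∈W , z∉C , c , c∈C , c~z) none
      ... | yes (z , z∈W , z∉C , c₀ , c₀∈C , c₀~z) =
        grow (C ∪ ⁅ z ⁆) (larger (p⊆p∪⁅y⁆ z , z , y∈p∪⁅y⁆ z , z∉C)) (p∪⁅y⁆⊆q C⊆W z∈W) (p⊆p∪⁅y⁆ z y∈C) connected′
        where
        widen : ∀ {c c'} → WalkWithin (_∈ C) c c' → WalkWithin (_∈ C ∪ ⁅ z ⁆) c c'
        widen = WalkWithin-map (p⊆p∪⁅y⁆ z)
        connected′ : ∀ {c c'} → c ∈ C ∪ ⁅ z ⁆ → c' ∈ C ∪ ⁅ z ⁆ → WalkWithin (_∈ C ∪ ⁅ z ⁆) c c'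
        connected′ c∈ c'∈ with x∈p∪⁅y⁆⁻ c∈ | x∈p∪⁅y⁆⁻ c'∈
        ... | inj₁ c∈C  | inj₁ c'∈C = widen (connected c∈C c'∈C)
        ... | inj₁ c∈C  | inj₂ refl = widen (connected c∈C c₀∈C) ▻ (c₀~z , y∈p∪⁅y⁆ z)
        ... | inj₂ refl | inj₁ c'∈C = (Adj-sym c₀~z , p⊆p∪⁅y⁆ z c₀∈C) ◅ widen (connected c₀∈C c'∈C)
        ... | inj₂ refl | inj₂ refl = []ʷ

    component : y ∈ W → Component W y
    component y∈W = grow ⁅ y ⁆ (⊃-wellFounded _) ⁅y⁆⊆W (x∈⁅x⁆ y) connected
      where
      ⁅y⁆⊆W : ⁅ y ⁆ ⊆ W
      ⁅y⁆⊆W x∈ rewrite x∈⁅y⁆⇒x≡y y x∈ = y∈W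
      connected : ∀ {c c'} → c ∈ ⁅ y ⁆ → c' ∈ ⁅ y ⁆ → WalkWithin (_∈ ⁅ y ⁆) c c'
      connected c∈ c'∈ rewrite x∈⁅y⁆⇒x≡y y c∈ | x∈⁅y⁆⇒x≡y y c'∈ = []ʷ

  HasNonNeighbour : Subset n → Fin n → Set
  HasNonNeighbour U x = ∃ λ y → y ∈ U × ¬ Near x y

  hasNonNeighbour? : ∀ U x → Dec (HasNonNeighbour U x)
  hasNonNeighbour? U x = any? λ y → y ∈? U ×-dec ¬? (Near? x y)

  SimplicialNonNeighbour : Subset n → Fin n → Set
  SimplicialNonNeighbour U x = ∃ λ s → s ∈ U × Simplicial U s × ¬ Near x s

  ¬HasNonNeighbour⇒Near : ∀ {U z} → ¬ HasNonNeighbour U z → ∀ {w} → w ∈ U → Near z w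
  ¬HasNonNeighbour⇒Near {z = z} none {w} w∈U with Near? z w
  ... | yes near = near
  ... | no ¬near = contradiction (w , w∈U , ¬near) none

  clique⇒Simplicial : ∀ {U s} → (∀ {z} → z ∈ U → ¬ HasNonNeighbour U z) → Simplicial U s
  clique⇒Simplicial none u∈U v∈U _ _ = Near⇒Adj (¬HasNonNeighbour⇒Near (none u∈U) v∈U)

  module _ (chordal : Chordal G) where

    -- The walk shortcuts to a chordless a–b path, which closes up through x into a hole.
    no-hole : ∀ {x a b} → WalkWithin (λ z → ¬ Near x z ⊎ z ≡ b) a b → Adj G x a → Adj G x b → ¬ Near a b → ⊥
    no-hole {x} {a} {b} record { inner = l ; walk = walk ; ends = refl ; within = within } x~a x~b a≁b
      with shortcut a l walk
    ... | record { path = [] ; sameEnd = a≡b } = a≁b (inj₁ a≡b)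
    ... | record { path = v ∷ [] ; chordless = a~v , _ ; sameEnd = v≡b } = a≁b (inj₂ (subst (Adj G a) v≡b a~v))
    ... | record { path = q@(v ∷ w ∷ r) ; chordless = chordless ; sameEnd = q-end ; ⊆-walk = ⊆-walk } =
      chordal (length r) (x ∷ᶠ p) (closeCycle p-induced (proj₁ ∘ attachment) (proj₂ ∘ attachment))
      where
      k : ℕ
      k = length r
      p : Fin (3 + k) → Fin n
      p = lookup (a ∷ q)
      p-induced : IsInducedPath p
      p-induced = chordlessPath⇒isInducedPath (a ∷ q) chordless
      p-last : p (Fin.fromℕ (2 + k)) ≡ b
      p-last = trans (lookup-last a q) q-end
      isLast : ∀ j → toℕ j ≡ 2 + k → j ≡ Fin.fromℕ (2 + k)
      isLast j eq = Fin.toℕ-injective (trans eq (sym (Fin.toℕ-fromℕ (2 + k))))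
      attachment : ∀ j → x ≢ p j × (Adj G x (p j) ⇔ (toℕ j ≡ 0 ⊎ toℕ j ≡ 2 + k))
      attachment zero = Adj⇒≢ x~a , mk⇔ (λ _ → inj₁ refl) (λ _ → x~a)
      attachment (suc j) with suc (toℕ j) ℕ.≟ 2 + k
      ... | yes last = Adj⇒≢ x~pj , mk⇔ (λ _ → inj₂ last) (λ _ → x~pj)
        where
        x~pj : Adj G x (p (suc j))
        x~pj = subst (Adj G x) (sym (trans (cong p (isLast (suc j) last)) p-last)) x~b
      ... | no ¬last with All.lookup within (⊆-walk (∈-lookup j))
      ...   | inj₁ ¬near = (λ x≡pj → ¬near (inj₁ x≡pj)) ,
                           mk⇔ (λ x~pj → contradiction (inj₂ x~pj) ¬near) [ (λ ()) , (λ last → contradiction last ¬last) ]′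
      ...   | inj₂ pj≡b = contradiction (cong toℕ (proj₁ p-induced (trans pj≡b (sym p-last))))
                                        (λ eq → ¬last (trans eq (Fin.toℕ-fromℕ (2 + k))))


    -- y lies in the component C of G[U ∖ N[x]]; B is the part of N(x) seeing C, which chordality makes a clique.
    module Separated {U : Subset n} {x y : Fin n} (x∈U : x ∈ U) (x≁y : ¬ Near x y)
                     (K : Component (U ∖N[ x ]) y) where

      open Component K

      private
        inB? : ∀ z → Dec (z ∈ U × Adj G x z × ∃ λ c → c ∈ C × Adj G z c)
        inB? z = z ∈? U ×-dec adj? x z ×-dec any? (λ c → c ∈? C ×-dec adj? z c)

      B : Subset n
      B = subset inB?

      ∈B⁺ : ∀ {z} → z ∈ U → Adj G x z → ∀ {c} → c ∈ C → Adj G z c → z ∈ B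
      ∈B⁺ z∈U x~z c∈C z~c = ∈-subset⁺ inB? (z∈U , x~z , _ , c∈C , z~c)

      ∈B⁻ : ∀ {z} → z ∈ B → z ∈ U × Adj G x z × ∃ λ c → c ∈ C × Adj G z c
      ∈B⁻ = ∈-subset⁻ inB?

      x≁C : ∀ {c} → c ∈ C → ¬ Near x c
      x≁C c∈C = proj₂ (∈∖N⁻ (C⊆W c∈C))

      B-clique : ∀ {a b} → a ∈ B → b ∈ B → a ≢ b → Adj G a b
      B-clique {a} {b} a∈B b∈B a≢b with adj? a b | ∈B⁻ a∈B | ∈B⁻ b∈B
      ... | yes a~b | _ | _ = a~b
      ... | no a≁b | _ , x~a , cₐ , cₐ∈C , a~cₐ | _ , x~b , c_b , c_b∈C , b~c_b =
        ⊥-elim (no-hole hole x~a x~b [ a≢b , a≁b ]′)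
        where
        hole : WalkWithin (λ z → ¬ Near x z ⊎ z ≡ b) a b
        hole = (a~cₐ , inj₁ (x≁C cₐ∈C)) ◅ (WalkWithin-map (inj₁ ∘ x≁C) (connected cₐ∈C c_b∈C) ▻ (Adj-sym b~c_b , inj₂ refl))

      U′ : Subset n
      U′ = C ∪ B

      U′⊆U : U′ ⊆ U
      U′⊆U z∈ = [ (λ z∈C → ∖N⊆ (C⊆W z∈C)) , (λ z∈B → proj₁ (∈B⁻ z∈B)) ]′ (x∈p∪q⁻ C B z∈)

      U′⊂U : U′ ⊂ U
      U′⊂U = U′⊆U , x , x∈U , λ x∈ → [ (λ x∈C → x≁C x∈C (inj₁ refl)) , (λ x∈B → Adj-irrefl (proj₁ (proj₂ (∈B⁻ x∈B)))) ]′
                                        (x∈p∪q⁻ C B x∈)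

      -- Every neighbour in U of a vertex s of C lies in C or in B.
      simplicial-lift : ∀ {s} → s ∈ C → Simplicial U′ s → Simplicial U s
      simplicial-lift {s} s∈C simplicial u∈U v∈U s~u s~v = simplicial (nbr∈U′ u∈U s~u) (nbr∈U′ v∈U s~v) s~u s~v
        where
        nbr∈U′ : ∀ {u} → u ∈ U → Adj G s u → u ∈ U′
        nbr∈U′ {u} u∈U s~u with Near? x u
        ... | no x≁u = x∈p∪q⁺ (inj₁ (closed s∈C (∈∖N⁺ u∈U x≁u) s~u))
        ... | yes (inj₂ x~u) = x∈p∪q⁺ (inj₂ (∈B⁺ u∈U x~u s∈C (Adj-sym s~u)))
        ... | yes (inj₁ refl) = contradiction (inj₂ (Adj-sym s~u)) (x≁C s∈C)

      ∈U′∖B⇒∈C : ∀ {z} → z ∈ U′ → z ∉ B → z ∈ C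
      ∈U′∖B⇒∈C z∈U′ z∉B = [ (λ z∈C → z∈C) , (λ z∈B → contradiction z∈B z∉B) ]′ (x∈p∪q⁻ C B z∈U′)

      -- If a vertex b of B has a non-neighbour in U′, one that is simplicial is not in the clique B.
      -- Otherwise B sees all of U′, so one simplicial non-neighbour of c ∈ C is not in B.
      -- If neither exists, U′ is a clique and y will do.
      simplicial-in-C : (∀ {z} → z ∈ U′ → HasNonNeighbour U′ z → SimplicialNonNeighbour U′ z) →
                        ∃ λ s → s ∈ C × Simplicial U′ s
      simplicial-in-C ih with any? (λ b → b ∈? B ×-dec hasNonNeighbour? U′ b)
      ... | yes (b , b∈B , far) with ih (q⊆p∪q C B b∈B) far
      ...   | s , s∈U′ , simplicial , b≁s =
        s , ∈U′∖B⇒∈C s∈U′ (λ s∈B → b≁s (inj₂ (B-clique b∈B s∈B (b≁s ∘ inj₁)))) , simplicial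
      simplicial-in-C ih | no noFarB with any? (λ c → c ∈? C ×-dec hasNonNeighbour? U′ c)
      ... | yes (c , c∈C , far) with ih (p⊆p∪q B c∈C) far
      ...   | s , s∈U′ , simplicial , c≁s =
        s , ∈U′∖B⇒∈C s∈U′ (λ s∈B → c≁s (Near-sym (¬HasNonNeighbour⇒Near (λ far → noFarB (s , s∈B , far)) (p⊆p∪q B c∈C)))) ,
        simplicial
      simplicial-in-C ih | no noFarB | no noFarC = y , y∈C , clique⇒Simplicial noFar
        where
        noFar : ∀ {z} → z ∈ U′ → ¬ HasNonNeighbour U′ z
        noFar z∈ far = [ (λ z∈C → noFarC (_ , z∈C , far)) , (λ z∈B → noFarB (_ , z∈B , far)) ]′ (x∈p∪q⁻ C B z∈)

      simplicialNonNeighbour : (∀ {z} → z ∈ U′ → HasNonNeighbour U′ z → SimplicialNonNeighbour U′ z) →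
                               SimplicialNonNeighbour U x
      simplicialNonNeighbour ih with simplicial-in-C ih
      ... | s , s∈C , simplicial = s , ∖N⊆ (C⊆W s∈C) , simplicial-lift s∈C simplicial , x≁C s∈C

    dirac : ∀ U → Acc _⊂_ U → ∀ {x} → x ∈ U → HasNonNeighbour U x → SimplicialNonNeighbour U x
    dirac U (acc smaller) x∈U (y , y∈U , x≁y) =
      simplicialNonNeighbour λ z∈U′ → dirac U′ (smaller U′⊂U) z∈U′
      where open Separated x∈U x≁y (component (∈∖N⁺ y∈U x≁y))

    simplicialVertex : ∀ U → Nonempty U → ∃ λ s → s ∈ U × Simplicial U s
    simplicialVertex U (x , x∈U) with any? (λ z → z ∈? U ×-dec hasNonNeighbour? U z)
    ... | yes (z , z∈U , far) = Product.map₂ (Product.map₂ proj₁) (dirac U (⊂-wellFounded U) z∈U far)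
    simplicialVertex U (x , x∈U) | no noFar = x , x∈U , clique⇒Simplicial λ z∈U far → noFar (_ , z∈U , far)

-- The neighbourhood complexes of Ḡ and of K_m

module _ {n : ℕ} (H : Graph n) {v x : Fin n} where

  lookup-nbhd : Vec.lookup (nbhd H v) x ≡ adj H v x
  lookup-nbhd with adj H v x | Vec.lookup∘tabulate (λ u → if adj H v u then inside else outside) x
  ... | true  | eq = eq
  ... | false | eq = eq

  ∈nbhd⇔ : x ∈ nbhd H v ⇔ Adj H v x
  ∈nbhd⇔ = mk⇔ (λ x∈ → trans (sym lookup-nbhd) (Vec.[]=⇒lookup x∈)) (λ v~x → Vec.lookup⇒[]= x _ (trans lookup-nbhd v~x))

Adj-complement⇔ : ∀ {n} (G : Graph n) {v x} → Adj (complement G) v x ⇔ (¬ Near G v x)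
Adj-complement⇔ G {v} {x} = mk⇔ into back
  where
  into : Adj (complement G) v x → ¬ Near G v x
  into v~x with adj G v x | v ≟ x
  into () | true | _
  into () | false | yes _
  into _ | false | no v≢x = [ v≢x , (λ ()) ]′
  back : ¬ Near G v x → Adj (complement G) v x
  back ¬near with adj G v x | v ≟ x
  ... | true | _ = contradiction (inj₂ refl) ¬near
  ... | false | yes v≡x = contradiction (inj₁ v≡x) ¬near
  ... | false | no _ = refl

Adj-complete⇔ : ∀ {m} {i j : Fin m} → Adj (complete m) i j ⇔ i ≢ j
Adj-complete⇔ {i = i} {j} = mk⇔ into back
  where
  into : Adj (complete _) i j → i ≢ j
  into i~j with i ≟ j
  into () | yes _
  ... | no i≢j = i≢j
  back : i ≢ j → Adj (complete _) i j
  back i≢j with i ≟ j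
  ... | yes i≡j = contradiction i≡j i≢j
  ... | no _ = refl

coNbhd-⊤≋𝒩complement : ∀ {n} (G : Graph n) → CoNbhd G ⊤ ≋ NeighborhoodComplex (complement G)
coNbhd-⊤≋𝒩complement G ρ = mk⇔ into back
  where
  into : CoNbhd G ⊤ ρ → NeighborhoodComplex (complement G) ρ
  into (_ , v , _ , v∉ρ , v≁ρ) =
    v , λ x∈ρ → from (∈nbhd⇔ (complement G)) (from (Adj-complement⇔ G) [ (λ { refl → v∉ρ x∈ρ }) , v≁ρ x∈ρ ]′)
  back : NeighborhoodComplex (complement G) ρ → CoNbhd G ⊤ ρ
  back (v , ρ⊆N) = (λ _ → ∈⊤) , v , ∈⊤ , (λ v∈ρ → v≉ v∈ρ (inj₁ refl)) , λ x∈ρ v~x → v≉ x∈ρ (inj₂ v~x)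
    where
    v≉ : ∀ {x} → x ∈ ρ → ¬ Near G v x
    v≉ x∈ρ = to (Adj-complement⇔ G) (to (∈nbhd⇔ (complement G)) (ρ⊆N x∈ρ))

-- Through an enumeration of A, a proper subset of A is a set of indices avoiding some index.
∂Δ≅𝒩complete : ∀ {n} (A : Subset n) → IsomorphicTo (∂Δ A) (NeighborhoodComplex (complete ∣ A ∣))
∂Δ≅𝒩complete A = f , enumerate-injective A , λ σ → mk⇔ (into σ) (back σ)
  where
  f : Fin ∣ A ∣ → Fin _
  f = enumerate A
  into : ∀ σ → ∂Δ A σ → Σ (Subset ∣ A ∣) λ τ → NeighborhoodComplex (complete ∣ A ∣) τ × Image f τ σ
  into σ (σ⊆A , x , x∈A , x∉σ) = τ , (i₀ , τ⊆N) , image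
    where
    τ : Subset ∣ A ∣
    τ = subset (λ i → f i ∈? σ)
    i₀ : Fin ∣ A ∣
    i₀ = proj₁ (enumerate-surjective A x∈A)
    τ⊆N : τ ⊆ nbhd (complete ∣ A ∣) i₀
    τ⊆N {i} i∈τ = from (∈nbhd⇔ (complete _)) (from Adj-complete⇔ λ { refl →
      x∉σ (subst (_∈ σ) (proj₂ (enumerate-surjective A x∈A)) (∈-subset⁻ (λ i → f i ∈? σ) i∈τ)) })
    image : Image f τ σ
    image u = mk⇔ (λ u∈σ → let i , fi≡u = enumerate-surjective A (σ⊆A u∈σ)
                            in i , ∈-subset⁺ (λ i → f i ∈? σ) (subst (_∈ σ) (sym fi≡u) u∈σ) , fi≡u)
                  (λ (i , i∈τ , fi≡u) → subst (_∈ σ) fi≡u (∈-subset⁻ (λ i → f i ∈? σ) i∈τ))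
  back : ∀ σ → Σ (Subset ∣ A ∣) (λ τ → NeighborhoodComplex (complete ∣ A ∣) τ × Image f τ σ) → ∂Δ A σ
  back σ (τ , (v , τ⊆N) , image) = σ⊆A , f v , enumerate-∈ A v , fv∉σ
    where
    σ⊆A : σ ⊆ A
    σ⊆A {u} u∈σ = let i , _ , fi≡u = to (image u) u∈σ in subst (_∈ A) fi≡u (enumerate-∈ A i)
    fv∉σ : f v ∉ σ
    fv∉σ fv∈σ = let i , i∈τ , fi≡fv = to (image (f v)) fv∈σ
                in to Adj-complete⇔ (to (∈nbhd⇔ (complete _)) (τ⊆N i∈τ)) (sym (enumerate-injective A fi≡fv))

proposition4p9 : {n : ℕ} (G : Graph n) → Chordal G → (a : ℕ) → IsIndependenceNumber G a →
    Σ (Complex n) λ Y → Collapses (NeighborhoodComplex (complement G)) Y ×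
      IsomorphicTo Y (NeighborhoodComplex (complete a))
proposition4p9 G chordal a ((S , S-independent , ∣S∣≡a) , α-maximum) =
  ∂Δ A ,
  collapses-respˡ-≋ (coNbhd-⊤≋𝒩complement G) collapse ,
  subst (λ m → IsomorphicTo (∂Δ A) (NeighborhoodComplex (complete m))) ∣A∣≡a (∂Δ≅𝒩complete A)
  where
  open BoundaryCollapse (boundaryCollapse G (simplicialVertex G chordal) ⊤)
  ∣A∣≡a : ∣ A ∣ ≡ a
  ∣A∣≡a = ℕ.≤-antisym (α-maximum A independent) (subst (_≤ ∣ A ∣) ∣S∣≡a (maximum S (λ _ → ∈⊤) S-independent))
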